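{- Let $d\ge1$ and $0\le a\le k$ be integers. The coefficient of the Schur function $s_{(2d)}$ in the Kronecker product $$\underbrace{h_{(d,d)}\ast\cdots\ast h_{(d,d)}}_{a\text{ times}}\ast\underbrace{h_{(d+1,d-1)}\ast\cdots\ast h_{(d+1,d-1)}}_{k-a\text{ times}}$$ equals the number of set valued tableaux of shape $(r)$, for some $r\le 2d$, whose content is $\{1^d,2^d,\ldots,a^d,(a+1)^{d-1},\ldots,k^{d-1}\}$.
   Context: $h_{(\mu_1,\mu_2)}=h_{\mu_1}h_{\mu_2}$ with $h_m$ the complete homogeneous symmetric function. The Kronecker product $\ast$ is the bilinear product on symmetric functions with $\frac{p_\lambda}{z_\lambda}\ast\frac{p_\mu}{z_\mu}=\delta_{\lambda\mu}\frac{p_\lambda}{z_\lambda}$ ($p$ power sums, $z_\lambda=\prod_i i^{m_i}m_i!$). A set valued tableau of shape $(r)$ is a single row of $r$ cells, each filled with a nonempty set of positive integers, such that the labels weakly increase from left to right in reverse lexicographic order (compare largest elements, then second largest, etc.; $M<N$ if at the first difference $M$'s element is smaller, or if all compared agree and $M$ has fewer elements). Its content is the multiset union of its labels. -}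

module Defs where

open import Data.Nat as ℕ using (ℕ; zero; suc; _≤_; _<_; _≥?_)
import Data.Nat.Properties as ℕP
open import Data.Nat using (_!)
open import Data.Integer using (+_)
open import Data.Rational using (ℚ; _/_; 0ℚ; 1ℚ; _+_; _*_)
open import Data.List using (List; []; _∷_; _++_; replicate; map; foldr; concatMap; length; filter; upTo; applyUpTo)
import Data.List.Properties as LP
open import Data.List.Relation.Unary.All using (All)
open import Data.List.Relation.Unary.Linked using (Linked)
open import Data.Product using (_×_; _,_)
open import Relation.Binary.PropositionalEquality using (_≡_)
open import Relation.Nullary using (does)
open import Data.Bool using (if_then_else_)

-- Integer partitions, written as weakly decreasing lists of positive parts.

partsLE : ℕ → ℕ → List (List ℕ)
partsLE n zero = if does (n ℕ.≟ 0) then [] ∷ [] else []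
partsLE n (suc m) =
  partsLE n m ++
  concatMap (λ j → map (λ rest → replicate j (suc m) ++ rest)
                       (partsLE (n ℕ.∸ j ℕ.* suc m) m))
            (filter (λ j → j ℕ.* suc m ℕ.≤? n) (applyUpTo suc n))

Partitions : ℕ → List (List ℕ)
Partitions n = partsLE n n

mult : ℕ → List ℕ → ℕ
mult i xs = length (filter (λ x → x ℕ.≟ i) xs)

z : List ℕ → ℕ
z λ′ = foldr ℕ._*_ 1 (map (λ i → (i ℕ.^ mult i λ′) ℕ.* (mult i λ′ !))
                          (applyUpTo suc (foldr ℕ._+_ 0 λ′)))

-- 1/n as a rational (only used for n = z_λ, which is never 0)
recip : ℕ → ℚ
recip zero = 0ℚ
recip (suc n) = (+ 1) / suc n

-- multiset union of two partitions (merge of weakly decreasing lists)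
∪ₚ : List ℕ → List ℕ → List ℕ
∪ₚ = Data.List.merge _≥?_
  where import Data.List

Σℚ : List ℚ → ℚ
Σℚ = foldr _+_ 0ℚ

-- Homogeneous symmetric functions of degree n, represented by their
-- coefficients in the basis p_λ / z_λ (λ ⊢ n):
--   f = Σ_{λ ⊢ n} f(λ) · p_λ / z_λ .

SymFn : Set
SymFn = List ℕ → ℚ

-- h_m = Σ_{λ ⊢ m} p_λ / z_λ : all coefficients equal to 1
hₘ : SymFn
hₘ _ = 1ℚ

-- h_{(μ₁,μ₂)} = h_{μ₁} h_{μ₂} = Σ_{α ⊢ μ₁, β ⊢ μ₂} p_{α ∪ β} / (z_α z_β),
-- so its coefficient at p_λ / z_λ is z_λ · Σ_{α ∪ β = λ} 1/(z_α z_β).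
h₂ : ℕ → ℕ → SymFn
h₂ μ₁ μ₂ λ′ =
  ((+ z λ′) / 1) *
  Σℚ (concatMap (λ α → concatMap (λ β →
        if does (LP.≡-dec ℕ._≟_ (∪ₚ α β) λ′)
        then (recip (z α) * recip (z β)) ∷ [] else [])
        (Partitions μ₂)) (Partitions μ₁))

-- Kronecker product: (p_λ/z_λ) ∗ (p_μ/z_μ) = δ_{λμ} p_λ/z_λ, i.e. pointwise.
_∗_ : SymFn → SymFn → SymFn
(f ∗ g) λ′ = f λ′ * g λ′

-- iterated Kronecker product of a list of factors in degree n;
-- the empty product is the unit h_n of ∗.
kronAll : List SymFn → SymFn
kronAll = foldr _∗_ hₘ

-- Schur function of a one-row shape: s_(n) = h_n
sRow : SymFn
sRow = hₘ

-- Hall inner product in degree n: ⟨p_λ, p_μ⟩ = δ z_λ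
hall : ℕ → SymFn → SymFn → ℚ
hall n f g = Σℚ (map (λ λ′ → f λ′ * g λ′ * recip (z λ′)) (Partitions n))

-- coefficient of s_(n) in a degree-n symmetric function f
-- (Schur functions are orthonormal for the Hall inner product)
coeffSRow : ℕ → SymFn → ℚ
coeffSRow n f = hall n f sRow

-- A label is a nonempty finite set of positive integers, written as a
-- strictly decreasing list (largest element first).
IsLabel : List ℕ → Set
IsLabel [] = Data.Empty.⊥ where import Data.Empty
IsLabel (x ∷ xs) = All (λ y → 0 < y) (x ∷ xs) × Linked (λ u v → v < u) (x ∷ xs)

-- reverse lexicographic order on labels (compare largest elements,
-- then second largest, ...; a proper "prefix" is smaller)
data _≤ʳ_ : List ℕ → List ℕ → Set where
  []≤   : ∀ {N} → [] ≤ʳ N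
  here  : ∀ {x y M N} → x < y → (x ∷ M) ≤ʳ (y ∷ N)
  there : ∀ {x M N} → M ≤ʳ N → (x ∷ M) ≤ʳ (x ∷ N)

IsSVTRow : ℕ → List (List ℕ) → Set
IsSVTRow r T = (length T ≡ r) × All IsLabel T × Linked _≤ʳ_ T

contentMult : List (List ℕ) → ℕ → ℕ
contentMult T i = foldr ℕ._+_ 0 (map (mult i) T)

targetMult : ℕ → ℕ → ℕ → ℕ → ℕ
targetMult d a k i =
  if does (1 ℕ.≤? i) then
    (if does (i ℕ.≤? a) then d else (if does (i ℕ.≤? k) then d ℕ.∸ 1 else 0))
  else 0

Counted : ℕ → ℕ → ℕ → List (List ℕ) → Set
Counted d a k T =
  (length T ≤ 2 ℕ.* d) × IsSVTRow (length T) T ×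
  ((i : ℕ) → contentMult T i ≡ targetMult d a k i)

factors : ℕ → ℕ → ℕ → List SymFn
factors d a k = replicate a (h₂ d d) ++ replicate (k ℕ.∸ a) (h₂ (suc d) (d ℕ.∸ 1))

module Submission where

-- The coefficient of s_(n) in a Kronecker product of functions h_μ is
-- Σ_{λ ⊢ n} z_λ⁻¹ ∏_j ⟨h_{μʲ}, p_λ⟩, and ⟨h_(μ₁,μ₂), p_λ⟩ = z_λ Σ_{α ∪ β = λ} z_α⁻¹ z_β⁻¹ counts the
-- ways of sending the parts of λ to two groups of sizes μ₁ and μ₂ (this is z_{α ∪ β} = N(α,β) z_α z_β).
-- A k-tuple of such choices is a colouring of the parts of λ by the subsets of {1, …, k}. Grouping the
-- colourings by the total weight carried by each colour and using Σ_{λ ⊢ m} z_λ⁻¹ = 1 for each colour,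
-- the sum collapses to the number of weightings of the subsets of {1, …, k}, of total n, whose
-- margins are the prescribed multiplicities. Such a weighting is a multiset of n subsets; its nonempty
-- members, listed in reverse lexicographic order, form exactly the counted one-row tableaux.

open import Level using (Level)
open import Algebra.Bundles using (CommutativeSemiring; CommutativeRing)
open import Data.Bool using (Bool; true; false; _∧_; if_then_else_; T; T?)
open import Data.Bool.Properties using (T-∧)
open import Data.Empty using (⊥; ⊥-elim)
import Data.Integer as ℤ
import Data.Integer.Properties as ℤP
import Data.Integer.Solver as ℤSolver
open import Data.List
  using (List; []; _∷_; _++_; map; concatMap; filter; length; replicate; applyUpTo; upTo; drop)
import Data.List.Properties as LP
open import Data.List.Relation.Binary.Disjoint.Propositional using (Disjoint)
open import Data.List.Membership.Propositional using (_∈_)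
open import Data.List.Membership.Propositional.Properties
open import Data.List.Relation.Unary.All as All using (All; []; _∷_)
import Data.List.Relation.Unary.All.Properties as AllP
open import Data.List.Relation.Unary.AllPairs as AllPairs using (AllPairs; []; _∷_)
import Data.List.Relation.Unary.AllPairs.Properties as AllPairsP
open import Data.List.Relation.Unary.Any using (here; there)
open import Data.List.Relation.Unary.Linked using (Linked; []; [-]; _∷_)
import Data.List.Relation.Unary.Linked.Properties as LinkedP
open import Data.List.Relation.Unary.Unique.Propositional using (Unique)
import Data.List.Relation.Unary.Unique.Propositional.Properties as UniqueP
open import Data.Nat as ℕ
  using (ℕ; zero; suc; _≤_; _<_; z≤n; s≤s; _≤?_; _≟_)
import Data.Nat.Properties as ℕP
open import Data.Nat.ListAction using (sum; product)
open import Data.Nat.ListAction.Properties using (sum-++; product-++)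
open import Data.Nat.Solver using (module +-*-Solver)
open import Data.Product using (Σ; ∃; _×_; _,_; proj₁; proj₂)
import Data.Product.Properties as ProductP
open import Data.Rational as ℚ using (ℚ; _/_; 0ℚ; 1ℚ; toℚᵘ)
import Data.Rational.Properties as ℚP
import Data.Rational.Solver as ℚSolver
import Data.Rational.Unnormalised as ℚᵘ
import Data.Rational.Unnormalised.Properties as ℚᵘP
open import Data.Sum using (_⊎_; inj₁; inj₂)
open import Function using (_∘_)
open import Function.Bundles using (_⇔_; mk⇔; Equivalence)
open import Relation.Binary.Definitions using (DecidableEquality; tri<; tri≈; tri>)
open import Relation.Binary.PropositionalEquality
open import Relation.Nullary using (Dec; yes; no; does; ¬_)
open import Relation.Nullary.Decidable using (dec-true; dec-false)
open import Relation.Unary using (Decidable)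
open import Relation.Unary.Properties using (∁?)

open import Defs

private variable
  a : Level
  A B : Set a

module ListSum {c ℓ} (R : CommutativeSemiring c ℓ) where
  open CommutativeSemiring R
    renaming (refl to ≈-refl; sym to ≈-sym; trans to ≈-trans; setoid to ≈-setoid)
  open import Relation.Binary.Reasoning.Setoid ≈-setoid

  ∑ : List A → (A → Carrier) → Carrier
  ∑ []       f = 0#
  ∑ (x ∷ xs) f = f x + ∑ xs f

  ∑-cong-∈ : ∀ (xs : List A) {f g} → (∀ {x} → x ∈ xs → f x ≈ g x) → ∑ xs f ≈ ∑ xs g
  ∑-cong-∈ []       f≈g = ≈-refl
  ∑-cong-∈ (x ∷ xs) f≈g = +-cong (f≈g (here refl)) (∑-cong-∈ xs (f≈g ∘ there))

  ∑-cong : ∀ (xs : List A) {f g} → (∀ x → f x ≈ g x) → ∑ xs f ≈ ∑ xs g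
  ∑-cong xs f≈g = ∑-cong-∈ xs (λ {x} _ → f≈g x)

  ∑-++ : ∀ (xs ys : List A) (f : A → Carrier) → ∑ (xs ++ ys) f ≈ ∑ xs f + ∑ ys f
  ∑-++ []       ys f = ≈-sym (+-identityˡ _)
  ∑-++ (x ∷ xs) ys f = ≈-trans (+-congˡ (∑-++ xs ys f)) (≈-sym (+-assoc _ _ _))

  ∑-map : ∀ (g : A → B) xs (f : B → Carrier) → ∑ (map g xs) f ≈ ∑ xs (f ∘ g)
  ∑-map g []       f = ≈-refl
  ∑-map g (x ∷ xs) f = +-congˡ (∑-map g xs f)

  ∑-concatMap : ∀ (g : A → List B) xs (f : B → Carrier) → ∑ (concatMap g xs) f ≈ ∑ xs (λ x → ∑ (g x) f)
  ∑-concatMap g []       f = ≈-refl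
  ∑-concatMap g (x ∷ xs) f = ≈-trans (∑-++ (g x) _ f) (+-congˡ (∑-concatMap g xs f))

  ∑-zero : ∀ (xs : List A) → ∑ xs (λ _ → 0#) ≈ 0#
  ∑-zero []       = ≈-refl
  ∑-zero (x ∷ xs) = ≈-trans (+-identityˡ _) (∑-zero xs)

  ∑-distrib-+ : ∀ (xs : List A) (f g : A → Carrier) → ∑ xs (λ x → f x + g x) ≈ ∑ xs f + ∑ xs g
  ∑-distrib-+ []       f g = ≈-sym (+-identityˡ _)
  ∑-distrib-+ (x ∷ xs) f g = begin
    (f x + g x) + ∑ xs (λ y → f y + g y) ≈⟨ +-congˡ (∑-distrib-+ xs f g) ⟩
    (f x + g x) + (∑ xs f + ∑ xs g)      ≈⟨ +-assoc _ _ _ ⟩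
    f x + (g x + (∑ xs f + ∑ xs g))      ≈⟨ +-congˡ (≈-sym (+-assoc _ _ _)) ⟩
    f x + ((g x + ∑ xs f) + ∑ xs g)      ≈⟨ +-congˡ (+-congʳ (+-comm _ _)) ⟩
    f x + ((∑ xs f + g x) + ∑ xs g)      ≈⟨ +-congˡ (+-assoc _ _ _) ⟩
    f x + (∑ xs f + (g x + ∑ xs g))      ≈⟨ ≈-sym (+-assoc _ _ _) ⟩
    (f x + ∑ xs f) + (g x + ∑ xs g)      ∎

  ∑-distribˡ : ∀ (xs : List A) c (f : A → Carrier) → ∑ xs (λ x → c * f x) ≈ c * ∑ xs f
  ∑-distribˡ []       c f = ≈-sym (zeroʳ c)
  ∑-distribˡ (x ∷ xs) c f = ≈-trans (+-congˡ (∑-distribˡ xs c f)) (≈-sym (distribˡ c _ _))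

  ∑-distribʳ : ∀ (xs : List A) c (f : A → Carrier) → ∑ xs (λ x → f x * c) ≈ ∑ xs f * c
  ∑-distribʳ xs c f = ≈-trans (∑-cong xs (λ x → *-comm (f x) c)) (≈-trans (∑-distribˡ xs c f) (*-comm c _))

  ∑-comm : ∀ (xs : List A) (ys : List B) (f : A → B → Carrier) → ∑ xs (λ x → ∑ ys (f x)) ≈ ∑ ys (λ y → ∑ xs (λ x → f x y))
  ∑-comm []       ys f = ≈-sym (∑-zero ys)
  ∑-comm (x ∷ xs) ys f = ≈-trans (+-congˡ (∑-comm xs ys f)) (≈-sym (∑-distrib-+ ys (f x) _))

  ∑-supported-at : ∀ {xs : List A} (f : A → Carrier) {m} → Unique xs → m ∈ xs →
                   (∀ {x} → x ∈ xs → x ≢ m → f x ≈ 0#) → ∑ xs f ≈ f m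
  ∑-supported-at {xs = x ∷ xs} f (x∉ ∷ !xs) (here refl) f≈0 = begin
    f x + ∑ xs f  ≈⟨ +-congˡ (∑-cong-∈ xs (λ y∈ → f≈0 (there y∈) (λ { refl → All.lookup x∉ y∈ refl }))) ⟩
    f x + ∑ xs (λ _ → 0#) ≈⟨ +-congˡ (∑-zero xs) ⟩
    f x + 0#      ≈⟨ +-identityʳ _ ⟩
    f x           ∎
  ∑-supported-at {xs = x ∷ xs} f (x∉ ∷ !xs) (there m∈) f≈0 = begin
    f x + ∑ xs f  ≈⟨ +-congʳ (f≈0 (here refl) (λ { refl → All.lookup x∉ m∈ refl })) ⟩
    0# + ∑ xs f   ≈⟨ +-identityˡ _ ⟩
    ∑ xs f        ≈⟨ ∑-supported-at f !xs m∈ (f≈0 ∘ there) ⟩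
    f _           ∎

-- opened only here, since ListSum uses the _+_ and _*_ of its semiring
open import Data.Nat using (_+_; _*_; _∸_; _^_; _!)

ℚ-commutativeSemiring : CommutativeSemiring _ _
ℚ-commutativeSemiring = CommutativeRing.commutativeSemiring ℚP.+-*-commutativeRing

module ℕΣ = ListSum ℕP.+-*-commutativeSemiring
module ℚΣ = ListSum ℚ-commutativeSemiring

indB : Bool → ℕ
indB true  = 1
indB false = 0

ind : {P : Set a} → Dec P → ℕ
ind P? = indB (does P?)

ind-yes : ∀ {P : Set a} (P? : Dec P) → P → ind P? ≡ 1
ind-yes (yes _) _ = refl
ind-yes (no ¬p) p = ⊥-elim (¬p p)

ind-no : ∀ {P : Set a} (P? : Dec P) → ¬ P → ind P? ≡ 0
ind-no (yes p) ¬p = ⊥-elim (¬p p)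
ind-no (no _)  _  = refl

T-does⁻ : ∀ {P : Set a} (P? : Dec P) → T (does P?) → P
T-does⁻ (yes p) _ = p

T-does⁺ : ∀ {P : Set a} (P? : Dec P) → P → T (does P?)
T-does⁺ (yes _) _ = _
T-does⁺ (no ¬p) p = ¬p p

indB-∧ : ∀ x y → indB (x ∧ y) ≡ indB x * indB y
indB-∧ true  y = sym (ℕP.+-identityʳ (indB y))
indB-∧ false y = refl

module Counting (_≟ᴬ_ : DecidableEquality A) where

  count : A → List A → ℕ
  count e xs = ℕΣ.∑ xs (λ x → ind (e ≟ᴬ x))

  ∑-indicator : ∀ {E} (g : A → ℕ) → Unique E → ∀ {y} → y ∈ E →
                ℕΣ.∑ E (λ e → ind (e ≟ᴬ y) * g e) ≡ g y
  ∑-indicator {E} g !E {y} y∈ = begin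
    ℕΣ.∑ E (λ e → ind (e ≟ᴬ y) * g e)
      ≡⟨ ℕΣ.∑-supported-at _ !E y∈ (λ {e} _ e≢y → cong (_* g e) (ind-no (e ≟ᴬ y) e≢y)) ⟩
    ind (y ≟ᴬ y) * g y
      ≡⟨ cong (_* g y) (ind-yes (y ≟ᴬ y) refl) ⟩
    1 * g y
      ≡⟨ ℕP.*-identityˡ (g y) ⟩
    g y ∎
    where open ≡-Reasoning

  ∑-group : ∀ {E} (X : List A) (F : A → ℕ) → Unique E → All (_∈ E) X →
            ℕΣ.∑ X F ≡ ℕΣ.∑ E (λ e → count e X * F e)
  ∑-group {E} []      F !E []         = sym (ℕΣ.∑-zero E)
  ∑-group {E} (x ∷ X) F !E (x∈ ∷ X⊆) = begin
    F x + ℕΣ.∑ X F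
      ≡⟨ cong₂ _+_ (sym (∑-indicator F !E x∈)) (∑-group X F !E X⊆) ⟩
    ℕΣ.∑ E (λ e → ind (e ≟ᴬ x) * F e) + ℕΣ.∑ E (λ e → count e X * F e)
      ≡⟨ ℕΣ.∑-distrib-+ E _ _ ⟨
    ℕΣ.∑ E (λ e → ind (e ≟ᴬ x) * F e + count e X * F e)
      ≡⟨ ℕΣ.∑-cong E (λ e → ℕP.*-distribʳ-+ (F e) (ind (e ≟ᴬ x)) (count e X)) ⟨
    ℕΣ.∑ E (λ e → count e (x ∷ X) * F e) ∎
    where open ≡-Reasoning

∑-1≡length : ∀ (xs : List A) → ℕΣ.∑ xs (λ _ → 1) ≡ length xs
∑-1≡length []       = refl
∑-1≡length (x ∷ xs) = cong suc (∑-1≡length xs)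

∈-concatMap⁻′ : ∀ (f : A → List B) xs {y} → y ∈ concatMap f xs → ∃ λ x → x ∈ xs × y ∈ f x
∈-concatMap⁻′ f xs y∈ with ∈-concat⁻′ (map f xs) y∈
... | ys , y∈ys , ys∈ with ∈-map⁻ f ys∈
... | x , x∈ , refl = x , x∈ , y∈ys

∈-concatMap⁺′ : ∀ (f : A → List B) {xs x y} → x ∈ xs → y ∈ f x → y ∈ concatMap f xs
∈-concatMap⁺′ f x∈ y∈ = ∈-concat⁺′ y∈ (∈-map⁺ f x∈)

Unique-concatMap⁺ : ∀ (f : A → List B) {xs} → Unique xs → (∀ x → Unique (f x)) →
                    (∀ {x x′ y} → y ∈ f x → y ∈ f x′ → x ≡ x′) → Unique (concatMap f xs)
Unique-concatMap⁺ f {[]}     []         !f disjoint = []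
Unique-concatMap⁺ f {x ∷ xs} (x∉ ∷ !xs) !f disjoint =
  UniqueP.++⁺ (!f x) (Unique-concatMap⁺ f !xs !f disjoint) apart
  where
  apart : Disjoint (f x) (concatMap f xs)
  apart (y∈ , y∈′) with ∈-concatMap⁻′ f xs y∈′
  ... | x′ , x′∈ , y∈f = All.lookup x∉ x′∈ (disjoint y∈ y∈f)

Unique-map⁺-injectiveOn : ∀ (f : A → B) {xs} → (∀ {x y} → x ∈ xs → y ∈ xs → f x ≡ f y → x ≡ y) →
                          Unique xs → Unique (map f xs)
Unique-map⁺-injectiveOn f {[]}     inj []         = []
Unique-map⁺-injectiveOn f {x ∷ xs} inj (x∉ ∷ !xs) =
  All.tabulate fx∉ ∷ Unique-map⁺-injectiveOn f (λ p q → inj (there p) (there q)) !xs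
  where
  fx∉ : ∀ {y} → y ∈ map f xs → f x ≢ y
  fx∉ y∈ eq with ∈-map⁻ f y∈
  ... | x′ , x′∈ , refl = All.lookup x∉ x′∈ (inj (here refl) (there x′∈) eq)

fromℕ : ℕ → ℚ
fromℕ n = ℤ.+ n / 1

private
  toℚᵘ-fromℕ : ∀ n → toℚᵘ (fromℕ n) ℚᵘ.≃ ℚᵘ.mkℚᵘ (ℤ.+ n) 0
  toℚᵘ-fromℕ n = ℚP.toℚᵘ-fromℚᵘ (ℚᵘ.mkℚᵘ (ℤ.+ n) 0)

  toℚᵘ-recip : ∀ n → toℚᵘ (recip (suc n)) ℚᵘ.≃ ℚᵘ.mkℚᵘ (ℤ.+ 1) n
  toℚᵘ-recip n = ℚP.toℚᵘ-fromℚᵘ (ℚᵘ.mkℚᵘ (ℤ.+ 1) n)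

fromℕ-+ : ∀ m n → fromℕ (m + n) ≡ fromℕ m ℚ.+ fromℕ n
fromℕ-+ m n = ℚP.toℚᵘ-injective (ℚᵘP.≃-trans (toℚᵘ-fromℕ (m + n)) (ℚᵘP.≃-trans integral
  (ℚᵘP.≃-sym (ℚᵘP.≃-trans (ℚP.toℚᵘ-homo-+ (fromℕ m) (fromℕ n)) (ℚᵘP.+-cong (toℚᵘ-fromℕ m) (toℚᵘ-fromℕ n))))))
  where
  open ℤSolver.+-*-Solver
  integral : ℚᵘ.mkℚᵘ (ℤ.+ (m + n)) 0 ℚᵘ.≃ (ℚᵘ.mkℚᵘ (ℤ.+ m) 0 ℚᵘ.+ ℚᵘ.mkℚᵘ (ℤ.+ n) 0)
  integral = ℚᵘ.*≡* (trans (cong (ℤ._* ℤ.+ 1) (ℤP.pos-+ m n))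
    (solve 2 (λ x y → (x :+ y) :* con (ℤ.+ 1) := (x :* con (ℤ.+ 1) :+ y :* con (ℤ.+ 1)) :* con (ℤ.+ 1)) refl (ℤ.+ m) (ℤ.+ n)))

fromℕ-* : ∀ m n → fromℕ (m * n) ≡ fromℕ m ℚ.* fromℕ n
fromℕ-* m n = ℚP.toℚᵘ-injective (ℚᵘP.≃-trans (toℚᵘ-fromℕ (m * n)) (ℚᵘP.≃-trans integral
  (ℚᵘP.≃-sym (ℚᵘP.≃-trans (ℚP.toℚᵘ-homo-* (fromℕ m) (fromℕ n)) (ℚᵘP.*-cong (toℚᵘ-fromℕ m) (toℚᵘ-fromℕ n))))))
  where
  integral : ℚᵘ.mkℚᵘ (ℤ.+ (m * n)) 0 ℚᵘ.≃ (ℚᵘ.mkℚᵘ (ℤ.+ m) 0 ℚᵘ.* ℚᵘ.mkℚᵘ (ℤ.+ n) 0)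
  integral = ℚᵘ.*≡* (cong (ℤ._* ℤ.+ 1) (ℤP.pos-* m n))

recip-inverse : ∀ n → 1 ≤ n → recip n ℚ.* fromℕ n ≡ 1ℚ
recip-inverse (suc n) _ = ℚP.toℚᵘ-injective (ℚᵘP.≃-trans (ℚP.toℚᵘ-homo-* (recip (suc n)) (fromℕ (suc n)))
  (ℚᵘP.≃-trans (ℚᵘP.*-cong (toℚᵘ-recip n) (toℚᵘ-fromℕ (suc n))) integral))
  where
  integral : (ℚᵘ.mkℚᵘ (ℤ.+ 1) n ℚᵘ.* ℚᵘ.mkℚᵘ (ℤ.+ suc n) 0) ℚᵘ.≃ ℚᵘ.mkℚᵘ (ℤ.+ 1) 0
  integral = ℚᵘ.*≡* (trans (ℤP.*-identityʳ _) (trans (ℤP.*-identityˡ (ℤ.+ suc n))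
    (sym (trans (ℤP.*-identityˡ _) (cong (λ m → ℤ.+ suc m) (ℕP.*-identityʳ n))))))

∑-fromℕ : ∀ (xs : List A) (f : A → ℕ) → ℚΣ.∑ xs (λ x → fromℕ (f x)) ≡ fromℕ (ℕΣ.∑ xs f)
∑-fromℕ []       f = refl
∑-fromℕ (x ∷ xs) f = trans (cong (fromℕ (f x) ℚ.+_) (∑-fromℕ xs f)) (sym (fromℕ-+ (f x) _))

fromℕ-as-quotient : ∀ n a b c → n * a * b ≡ c → 1 ≤ a → 1 ≤ b →
                    fromℕ n ≡ fromℕ c ℚ.* (recip a ℚ.* recip b)
fromℕ-as-quotient n a b c eq 1≤a 1≤b = begin
  fromℕ n
    ≡⟨ sym (trans (ℚP.*-identityʳ _) (ℚP.*-identityʳ _)) ⟩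
  fromℕ n ℚ.* 1ℚ ℚ.* 1ℚ
    ≡⟨ cong₂ (λ u v → fromℕ n ℚ.* u ℚ.* v) (sym (recip-inverse a 1≤a)) (sym (recip-inverse b 1≤b)) ⟩
  fromℕ n ℚ.* (recip a ℚ.* fromℕ a) ℚ.* (recip b ℚ.* fromℕ b)
    ≡⟨ solve 5 (λ n a b x y → n :* (x :* a) :* (y :* b) := (n :* a :* b) :* (x :* y)) refl
             (fromℕ n) (fromℕ a) (fromℕ b) (recip a) (recip b) ⟩
  fromℕ n ℚ.* fromℕ a ℚ.* fromℕ b ℚ.* (recip a ℚ.* recip b)
    ≡⟨ cong (ℚ._* (recip a ℚ.* recip b)) (sym (trans (fromℕ-* (n * a) b) (cong (ℚ._* fromℕ b) (fromℕ-* n a)))) ⟩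
  fromℕ (n * a * b) ℚ.* (recip a ℚ.* recip b)
    ≡⟨ cong (λ t → fromℕ t ℚ.* (recip a ℚ.* recip b)) eq ⟩
  fromℕ c ℚ.* (recip a ℚ.* recip b) ∎
  where
  open ≡-Reasoning
  open ℚSolver.+-*-Solver

-- Partitions and z_λ

Decreasing : List ℕ → Set
Decreasing = AllPairs (λ x y → y ≤ x)

Positive : List ℕ → Set
Positive = All (1 ≤_)

IsPartition : ℕ → List ℕ → Set
IsPartition n xs = Decreasing xs × Positive xs × sum xs ≡ n

sum-replicate : ∀ j p → sum (replicate j p) ≡ j * p
sum-replicate zero    p = refl
sum-replicate (suc j) p = cong (p +_) (sum-replicate j p)

Decreasing-replicate-++ : ∀ j p {rest} → All (_≤ p) rest → Decreasing rest →
                          Decreasing (replicate j p ++ rest)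
Decreasing-replicate-++ zero    p ≤p dec = dec
Decreasing-replicate-++ (suc j) p ≤p dec =
  AllP.++⁺ (AllP.replicate⁺ j ℕP.≤-refl) ≤p ∷ Decreasing-replicate-++ j p ≤p dec

AllPairs-++⁻ʳ : ∀ {R : A → A → Set} xs {ys} → AllPairs R (xs ++ ys) → AllPairs R ys
AllPairs-++⁻ʳ []       rs       = rs
AllPairs-++⁻ʳ (x ∷ xs) (_ ∷ rs) = AllPairs-++⁻ʳ xs rs

All-≤-sum : ∀ xs → All (_≤ sum xs) xs
All-≤-sum []       = []
All-≤-sum (x ∷ xs) = ℕP.m≤m+n x _ ∷ All.map (λ y≤ → ℕP.≤-trans y≤ (ℕP.m≤n+m _ x)) (All-≤-sum xs)

-- partsLE n (suc m) lists the partitions with j leading parts equal to suc m, for each j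
leading-block : ∀ m xs → Decreasing xs → All (_≤ suc m) xs →
  Σ ℕ λ j → Σ (List ℕ) λ rest → xs ≡ replicate j (suc m) ++ rest × All (_≤ m) rest
leading-block m []       _          _          = 0 , [] , refl , []
leading-block m (x ∷ xs) (x≥ ∷ dec) (x≤ ∷ ≤sm) with x ≟ suc m
... | yes refl with leading-block m xs dec ≤sm
...   | j , rest , refl , ≤m = suc j , rest , refl , ≤m
leading-block m (x ∷ xs) (x≥ ∷ dec) (x≤ ∷ ≤sm) | no x≢ =
  0 , x ∷ xs , refl , x≤m ∷ All.map (λ y≤x → ℕP.≤-trans y≤x x≤m) x≥
  where x≤m = ℕP.≤-pred (ℕP.≤∧≢⇒< x≤ x≢)

replicate-++-injective : ∀ {p} j j′ {r r′} → replicate j p ++ r ≡ replicate j′ p ++ r′ →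
                         All (_< p) r → All (_< p) r′ → j ≡ j′
replicate-++-injective zero    zero     eq _        _         = refl
replicate-++-injective zero    (suc j′) {r = x ∷ r} eq (x< ∷ _) _ = ⊥-elim (ℕP.<-irrefl (LP.∷-injectiveˡ eq) x<)
replicate-++-injective (suc j) zero     {r′ = x ∷ r′} eq _ (x< ∷ _) = ⊥-elim (ℕP.<-irrefl (sym (LP.∷-injectiveˡ eq)) x<)
replicate-++-injective (suc j) (suc j′) eq r< r′< = cong suc (replicate-++-injective j j′ (LP.∷-injectiveʳ eq) r< r′<)

private
  block : ℕ → ℕ → ℕ → List (List ℕ)
  block n m j = map (replicate j (suc m) ++_) (partsLE (n ∸ j * suc m) m)

  multiplicities : ℕ → ℕ → List ℕ
  multiplicities n m = filter (λ j → j * suc m ≤? n) (applyUpTo suc n)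

  partsLE-sound : ∀ n m {xs} → xs ∈ partsLE n m → IsPartition n xs × All (_≤ m) xs
  partsLE-sound zero zero (here refl) = ([] , [] , refl) , []
  partsLE-sound n (suc m) xs∈ with ∈-++⁻ (partsLE n m) xs∈
  ... | inj₁ xs∈′ = let (isP , ≤m) = partsLE-sound n m xs∈′ in isP , All.map ℕP.m≤n⇒m≤1+n ≤m
  ... | inj₂ xs∈′ with ∈-concatMap⁻′ (block n m) _ xs∈′
  ... | j , j∈ , xs∈b with ∈-filter⁻ (λ j → j * suc m ≤? n) {xs = applyUpTo suc n} j∈ | ∈-map⁻ (replicate j (suc m) ++_) xs∈b
  ... | _ , j*sm≤n | rest , rest∈ , refl with partsLE-sound (n ∸ j * suc m) m rest∈
  ... | (dec , pos , Σrest) , ≤m =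
    (Decreasing-replicate-++ j (suc m) (All.map ℕP.m≤n⇒m≤1+n ≤m) dec ,
     AllP.++⁺ (AllP.replicate⁺ j (s≤s z≤n)) pos ,
     trans (sum-++ (replicate j (suc m)) rest) (trans (cong₂ _+_ (sum-replicate j (suc m)) Σrest) (ℕP.m+[n∸m]≡n j*sm≤n))) ,
    AllP.++⁺ (AllP.replicate⁺ j ℕP.≤-refl) (All.map ℕP.m≤n⇒m≤1+n ≤m)

  partsLE-complete : ∀ n m {xs} → IsPartition n xs → All (_≤ m) xs → xs ∈ partsLE n m
  partsLE-complete .0 zero {[]} (_ , _ , refl) _ = here refl
  partsLE-complete n zero {x ∷ xs} (_ , (1≤x ∷ _) , _) (x≤0 ∷ _) = ⊥-elim (ℕP.<-irrefl refl (ℕP.<-≤-trans 1≤x x≤0))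
  partsLE-complete n (suc m) {xs} (dec , pos , Σxs) ≤sm with leading-block m xs dec ≤sm
  ... | zero   , rest , refl , ≤m = ∈-++⁺ˡ (partsLE-complete n m (dec , pos , Σxs) ≤m)
  ... | suc j′ , rest , refl , ≤m =
    ∈-++⁺ʳ (partsLE n m) (∈-concatMap⁺′ (block n m) j∈ (∈-map⁺ (replicate j (suc m) ++_) rest∈))
    where
    j = suc j′
    Σ-split : j * suc m + sum rest ≡ n
    Σ-split = trans (cong (_+ sum rest) (sym (sum-replicate j (suc m)))) (trans (sym (sum-++ (replicate j (suc m)) rest)) Σxs)
    j*sm≤n : j * suc m ≤ n
    j*sm≤n = subst (j * suc m ≤_) Σ-split (ℕP.m≤m+n _ _)
    rest∈ : rest ∈ partsLE (n ∸ j * suc m) m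
    rest∈ = partsLE-complete (n ∸ j * suc m) m
              (AllPairs-++⁻ʳ (replicate j (suc m)) dec ,
               AllP.++⁻ʳ (replicate j (suc m)) pos ,
               trans (sym (ℕP.m+n∸m≡n (j * suc m) (sum rest))) (cong (_∸ j * suc m) Σ-split)) ≤m
    j∈ : j ∈ multiplicities n m
    j∈ = ∈-filter⁺ (λ j → j * suc m ≤? n) (∈-applyUpTo⁺ suc (ℕP.≤-trans (ℕP.m≤m*n j (suc m)) j*sm≤n)) j*sm≤n

  partsLE-unique : ∀ n m → Unique (partsLE n m)
  partsLE-unique zero    zero    = [] ∷ []
  partsLE-unique (suc n) zero    = []
  partsLE-unique n       (suc m) = UniqueP.++⁺ (partsLE-unique n m)
    (Unique-concatMap⁺ (block n m)
      (UniqueP.filter⁺ (λ j → j * suc m ≤? n) (UniqueP.applyUpTo⁺₁ suc n (λ i<j _ → ℕP.<⇒≢ (s≤s i<j))))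
      (λ j → UniqueP.map⁺ (LP.++-cancelˡ (replicate j (suc m)) _ _) (partsLE-unique (n ∸ j * suc m) m))
      same-block)
    apart
    where
    below : ∀ {n′ r} → r ∈ partsLE n′ m → All (_< suc m) r
    below r∈ = All.map s≤s (proj₂ (partsLE-sound _ m r∈))
    same-block : ∀ {j j′ xs} → xs ∈ block n m j → xs ∈ block n m j′ → j ≡ j′
    same-block {j} {j′} xs∈ xs∈′ with ∈-map⁻ (replicate j (suc m) ++_) xs∈ | ∈-map⁻ (replicate j′ (suc m) ++_) xs∈′
    ... | r , r∈ , refl | r′ , r′∈ , eq = replicate-++-injective j j′ eq (below r∈) (below r′∈)
    apart : Disjoint (partsLE n m) (concatMap (block n m) (multiplicities n m))
    apart (xs∈ , xs∈′) with ∈-concatMap⁻′ (block n m) _ xs∈′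
    ... | j , j∈ , xs∈b with ∈-filter⁻ (λ j → j * suc m ≤? n) {xs = applyUpTo suc n} j∈ | ∈-map⁻ (replicate j (suc m) ++_) xs∈b
    ... | j∈′ , _ | rest , _ , refl with ∈-applyUpTo⁻ suc j∈′
    ... | i , _ , refl with proj₂ (partsLE-sound n m xs∈)
    ... | sm≤m ∷ _ = ℕP.<-irrefl refl sm≤m

Partitions-sound : ∀ {n xs} → xs ∈ Partitions n → IsPartition n xs
Partitions-sound {n} xs∈ = proj₁ (partsLE-sound n n xs∈)

Partitions-complete : ∀ {n xs} → IsPartition n xs → xs ∈ Partitions n
Partitions-complete {xs = xs} isP@(_ , _ , refl) = partsLE-complete _ _ isP (All-≤-sum xs)

Partitions-unique : ∀ n → Unique (Partitions n)
Partitions-unique n = partsLE-unique n n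

sum-Partitions : ∀ {n xs} → xs ∈ Partitions n → sum xs ≡ n
sum-Partitions xs∈ = proj₂ (proj₂ (Partitions-sound xs∈))

mult-∷ : ∀ i x xs → mult i (x ∷ xs) ≡ ind (x ≟ i) + mult i xs
mult-∷ i x xs with x ≟ i
... | yes x≡i = trans (cong length (LP.filter-accept (_≟ i) x≡i)) (cong (_+ mult i xs) (sym (ind-yes (x ≟ i) x≡i)))
... | no  x≢i = trans (cong length (LP.filter-reject (_≟ i) x≢i)) (cong (_+ mult i xs) (sym (ind-no (x ≟ i) x≢i)))

mult-∷-≢ : ∀ {i x} xs → x ≢ i → mult i (x ∷ xs) ≡ mult i xs
mult-∷-≢ {i} xs x≢i = cong length (LP.filter-reject (_≟ i) x≢i)

mult-∷-≡ : ∀ i xs → mult i (i ∷ xs) ≡ suc (mult i xs)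
mult-∷-≡ i xs = cong length (LP.filter-accept (_≟ i) refl)

mult-absent : ∀ i xs → All (_≢ i) xs → mult i xs ≡ 0
mult-absent i []       []           = refl
mult-absent i (x ∷ xs) (x≢i ∷ xs≢i) = trans (mult-∷-≢ xs x≢i) (mult-absent i xs xs≢i)

mult-all< : ∀ i xs → All (_< i) xs → mult i xs ≡ 0
mult-all< i xs xs<i = mult-absent i xs (All.map ℕP.<⇒≢ xs<i)

private
  zFactor : List ℕ → ℕ → ℕ
  zFactor xs i = i ^ mult i xs * mult i xs !

  prodUpTo : (ℕ → ℕ) → ℕ → ℕ
  prodUpTo f N = product (map f (applyUpTo suc N))

  prodUpTo-suc : ∀ f N → prodUpTo f (suc N) ≡ prodUpTo f N * f (suc N)
  prodUpTo-suc f N = begin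
    product (map f (applyUpTo suc (suc N)))            ≡⟨ cong (product ∘ map f) (sym (LP.applyUpTo-∷ʳ suc N)) ⟩
    product (map f (applyUpTo suc N ++ suc N ∷ []))     ≡⟨ cong product (LP.map-++ f (applyUpTo suc N) _) ⟩
    product (map f (applyUpTo suc N) ++ f (suc N) ∷ []) ≡⟨ product-++ (map f (applyUpTo suc N)) _ ⟩
    prodUpTo f N * (f (suc N) * 1)                      ≡⟨ cong (prodUpTo f N *_) (ℕP.*-identityʳ _) ⟩
    prodUpTo f N * f (suc N)                            ∎
    where open ≡-Reasoning

  prodUpTo-cong : ∀ {f g} N → (∀ {i} → i ≤ N → f i ≡ g i) → prodUpTo f N ≡ prodUpTo g N
  prodUpTo-cong zero    f≡g = refl
  prodUpTo-cong {f} {g} (suc N) f≡g = begin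
    prodUpTo f (suc N)       ≡⟨ prodUpTo-suc f N ⟩
    prodUpTo f N * f (suc N) ≡⟨ cong₂ _*_ (prodUpTo-cong N (f≡g ∘ ℕP.m≤n⇒m≤1+n)) (f≡g ℕP.≤-refl) ⟩
    prodUpTo g N * g (suc N) ≡⟨ prodUpTo-suc g N ⟨
    prodUpTo g (suc N)       ∎
    where open ≡-Reasoning

  prodUpTo-ones : ∀ f {N M} → N ≤ M → (∀ {i} → N < i → f i ≡ 1) → prodUpTo f M ≡ prodUpTo f N
  prodUpTo-ones f {N} {M} N≤M f≡1 with ℕP.m≤n⇒m<n∨m≡n N≤M
  ... | inj₂ refl = refl
  prodUpTo-ones f {N} {suc M} _ f≡1 | inj₁ (s≤s N≤M) = begin
    prodUpTo f (suc M)       ≡⟨ prodUpTo-suc f M ⟩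
    prodUpTo f M * f (suc M) ≡⟨ cong₂ _*_ (prodUpTo-ones f N≤M f≡1) (f≡1 (s≤s N≤M)) ⟩
    prodUpTo f N * 1         ≡⟨ ℕP.*-identityʳ _ ⟩
    prodUpTo f N             ∎
    where open ≡-Reasoning

  zFactor-∷-≡ : ∀ p xs → zFactor (p ∷ xs) p ≡ p * suc (mult p xs) * zFactor xs p
  zFactor-∷-≡ p xs rewrite mult-∷-≡ p xs =
    solve 4 (λ p a b m → (p :* a) :* (b :+ m :* b) := p :* (con 1 :+ m) :* (a :* b)) refl
          p (p ^ mult p xs) (mult p xs !) (mult p xs)
    where open +-*-Solver

  zFactor-∷-≢ : ∀ {p i} xs → p ≢ i → zFactor (p ∷ xs) i ≡ zFactor xs i
  zFactor-∷-≢ xs p≢i rewrite mult-∷-≢ xs p≢i = refl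

  prodUpTo-zFactor-∷ : ∀ p xs {N} → 1 ≤ p → p ≤ N →
                       prodUpTo (zFactor (p ∷ xs)) N ≡ p * suc (mult p xs) * prodUpTo (zFactor xs) N
  prodUpTo-zFactor-∷ (suc p) xs {zero} _ ()
  prodUpTo-zFactor-∷ p xs {suc N} 1≤p p≤N with ℕP.m≤n⇒m<n∨m≡n p≤N
  ... | inj₂ refl = begin
    prodUpTo (zFactor (p ∷ xs)) p
      ≡⟨ prodUpTo-suc _ N ⟩
    prodUpTo (zFactor (p ∷ xs)) N * zFactor (p ∷ xs) p
      ≡⟨ cong₂ _*_ (prodUpTo-cong N (λ i≤N → zFactor-∷-≢ {p} xs (λ { refl → ℕP.<-irrefl refl (s≤s i≤N) }))) (zFactor-∷-≡ p xs) ⟩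
    prodUpTo (zFactor xs) N * (c * zFactor xs p)
      ≡⟨ solve 3 (λ a b c → a :* (b :* c) := b :* (a :* c)) refl (prodUpTo (zFactor xs) N) c (zFactor xs p) ⟩
    c * (prodUpTo (zFactor xs) N * zFactor xs p)
      ≡⟨ cong (c *_) (prodUpTo-suc _ N) ⟨
    c * prodUpTo (zFactor xs) p ∎
    where
    open ≡-Reasoning
    open +-*-Solver
    c = p * suc (mult p xs)
  ... | inj₁ (s≤s p≤N) = begin
    prodUpTo (zFactor (p ∷ xs)) (suc N)
      ≡⟨ prodUpTo-suc _ N ⟩
    prodUpTo (zFactor (p ∷ xs)) N * zFactor (p ∷ xs) (suc N)
      ≡⟨ cong₂ _*_ (prodUpTo-zFactor-∷ p xs 1≤p p≤N) (zFactor-∷-≢ xs (λ p≡ → ℕP.<-irrefl p≡ (s≤s p≤N))) ⟩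
    c * prodUpTo (zFactor xs) N * zFactor xs (suc N)
      ≡⟨ ℕP.*-assoc c _ _ ⟩
    c * (prodUpTo (zFactor xs) N * zFactor xs (suc N))
      ≡⟨ cong (c *_) (prodUpTo-suc _ N) ⟨
    c * prodUpTo (zFactor xs) (suc N) ∎
    where
    open ≡-Reasoning
    c = p * suc (mult p xs)

z-∷ : ∀ p xs → 1 ≤ p → z (p ∷ xs) ≡ p * suc (mult p xs) * z xs
z-∷ p xs 1≤p = begin
  prodUpTo (zFactor (p ∷ xs)) (p + sum xs)
    ≡⟨ prodUpTo-zFactor-∷ p xs 1≤p (ℕP.m≤m+n p _) ⟩
  p * suc (mult p xs) * prodUpTo (zFactor xs) (p + sum xs)
    ≡⟨ cong (p * suc (mult p xs) *_) (prodUpTo-ones (zFactor xs) (ℕP.m≤n+m _ p) beyond-sum) ⟩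
  p * suc (mult p xs) * z xs ∎
  where
  open ≡-Reasoning
  beyond-sum : ∀ {i} → sum xs < i → zFactor xs i ≡ 1
  beyond-sum {i} Σ<i rewrite mult-all< i xs (All.map (λ x≤ → ℕP.≤-<-trans x≤ Σ<i) (All-≤-sum xs)) = refl

z-positive : ∀ xs → Positive xs → 1 ≤ z xs
z-positive []       []           = s≤s z≤n
z-positive (x ∷ xs) (1≤x ∷ pos) rewrite z-∷ x xs 1≤x =
  ℕP.*-mono-≤ {1} {x * suc (mult x xs)} (ℕP.*-mono-≤ {1} {x} 1≤x (s≤s z≤n)) (z-positive xs pos)

-- Splitting the parts of a partition in two

ListPair : Set
ListPair = List ℕ × List ℕ

_≟ᴸ_ : DecidableEquality (List ℕ)
_≟ᴸ_ = LP.≡-dec _≟_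

_≟ᴾ_ : DecidableEquality ListPair
_≟ᴾ_ = ProductP.≡-dec _≟ᴸ_ _≟ᴸ_

consˡ : ℕ → ListPair → ListPair
consˡ p s = (p ∷ proj₁ s , proj₂ s)

consʳ : ℕ → ListPair → ListPair
consʳ p s = (proj₁ s , p ∷ proj₂ s)

splits : List ℕ → List ListPair
splits []      = ([] , []) ∷ []
splits (p ∷ l) = map (consˡ p) (splits l) ++ map (consʳ p) (splits l)

∑-splits : List ℕ → (List ℕ → List ℕ → ℕ) → ℕ
∑-splits l F = ℕΣ.∑ (splits l) (λ s → F (proj₁ s) (proj₂ s))

∑-splits-∷ : ∀ p l F → ∑-splits (p ∷ l) F ≡ ∑-splits l (λ β ρ → F (p ∷ β) ρ) + ∑-splits l (λ β ρ → F β (p ∷ ρ))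
∑-splits-∷ p l F = trans (ℕΣ.∑-++ (map (consˡ p) (splits l)) _ _)
  (cong₂ _+_ (ℕΣ.∑-map (consˡ p) (splits l) _) (ℕΣ.∑-map (consʳ p) (splits l) _))

∑-splits-cong : ∀ l {F G : List ℕ → List ℕ → ℕ} → (∀ β ρ → F β ρ ≡ G β ρ) → ∑-splits l F ≡ ∑-splits l G
∑-splits-cong l F≡G = ℕΣ.∑-cong (splits l) (λ s → F≡G (proj₁ s) (proj₂ s))

∈-splits-∷⁻ : ∀ {p l s} → s ∈ splits (p ∷ l) → ∃ λ t → t ∈ splits l × (s ≡ consˡ p t ⊎ s ≡ consʳ p t)
∈-splits-∷⁻ {p} {l} s∈ with ∈-++⁻ (map (consˡ p) (splits l)) s∈
... | inj₁ s∈ˡ = let t , t∈ , s≡ = ∈-map⁻ (consˡ p) s∈ˡ in t , t∈ , inj₁ s≡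
... | inj₂ s∈ʳ = let t , t∈ , s≡ = ∈-map⁻ (consʳ p) s∈ʳ in t , t∈ , inj₂ s≡

∪ₚ-[]ʳ : ∀ xs → ∪ₚ xs [] ≡ xs
∪ₚ-[]ʳ [] = refl
∪ₚ-[]ʳ (x ∷ xs) = refl

∪ₚ-≥ : ∀ {x y} xs ys → y ≤ x → ∪ₚ (x ∷ xs) (y ∷ ys) ≡ x ∷ ∪ₚ xs (y ∷ ys)
∪ₚ-≥ {x} {y} xs ys y≤x with y ℕ.≤ᵇ x | ℕP.≤⇒≤ᵇ y≤x
... | true | _ = refl

∪ₚ-< : ∀ {x y} xs ys → x < y → ∪ₚ (x ∷ xs) (y ∷ ys) ≡ y ∷ ∪ₚ (x ∷ xs) ys
∪ₚ-< {x} {y} xs ys x<y with y ℕ.≤ᵇ x in eq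
... | false = refl
... | true = ⊥-elim (ℕP.<⇒≱ x<y (ℕP.≤ᵇ⇒≤ y x (subst Data.Bool.T (sym eq) _)))

∪ₚ-∷ˡ : ∀ {p} xs ys → All (_≤ p) ys → ∪ₚ (p ∷ xs) ys ≡ p ∷ ∪ₚ xs ys
∪ₚ-∷ˡ xs [] a = cong (_ ∷_) (sym (∪ₚ-[]ʳ xs))
∪ₚ-∷ˡ xs (y ∷ ys) (h ∷ a) = ∪ₚ-≥ xs ys h

∪ₚ-∷ʳ : ∀ {p} xs ys → All (_≤ p) xs → All (_≤ p) ys → ∪ₚ xs (p ∷ ys) ≡ p ∷ ∪ₚ xs ys
∪ₚ-∷ʳ [] ys a b = refl
∪ₚ-∷ʳ {p} (x ∷ xs) ys (h ∷ a) b with ℕP.m≤n⇒m<n∨m≡n h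
... | inj₁ x<p = ∪ₚ-< xs ys x<p
... | inj₂ refl = trans (∪ₚ-≥ xs ys ℕP.≤-refl) (trans (cong (x ∷_) (∪ₚ-∷ʳ xs ys a b)) (cong (x ∷_) (sym (∪ₚ-∷ˡ xs ys b))))

module _ (Q : List ℕ → List ℕ → Set)
         (nilˡ : ∀ ys → Q [] ys) (nilʳ : ∀ x xs → Q (x ∷ xs) [])
         (takeˡ : ∀ x y xs ys → y ≤ x → Q xs (y ∷ ys) → Q (x ∷ xs) (y ∷ ys))
         (takeʳ : ∀ x y xs ys → x < y → Q (x ∷ xs) ys → Q (x ∷ xs) (y ∷ ys)) where

  ∪ₚ-ind : ∀ xs ys → Q xs ys
  ∪ₚ-ind []       ys = nilˡ ys
  ∪ₚ-ind (x ∷ xs) ys = ∪ₚ-ind-∷ ys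
    where
    ∪ₚ-ind-∷ : ∀ ys → Q (x ∷ xs) ys
    ∪ₚ-ind-∷ []       = nilʳ x xs
    ∪ₚ-ind-∷ (y ∷ ys) with y ≤? x
    ... | yes y≤x = takeˡ x y xs ys y≤x (∪ₚ-ind xs (y ∷ ys))
    ... | no  y≰x = takeʳ x y xs ys (ℕP.≰⇒> y≰x) (∪ₚ-ind-∷ ys)

All-∪ₚ : ∀ {P : ℕ → Set} xs ys → All P xs → All P ys → All P (∪ₚ xs ys)
All-∪ₚ {P} = ∪ₚ-ind (λ xs ys → All P xs → All P ys → All P (∪ₚ xs ys))
  (λ ys a b → b) (λ x xs a b → a)
  (λ x y xs ys y≤x ih → λ { (ha ∷ a) (hb ∷ b) → subst (All _) (sym (∪ₚ-≥ xs ys y≤x)) (ha ∷ ih a (hb ∷ b)) })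
  (λ x y xs ys x<y ih → λ { (ha ∷ a) (hb ∷ b) → subst (All _) (sym (∪ₚ-< xs ys x<y)) (hb ∷ ih (ha ∷ a) b) })

Decreasing-∪ₚ : ∀ xs ys → Decreasing xs → Decreasing ys → Decreasing (∪ₚ xs ys)
Decreasing-∪ₚ = ∪ₚ-ind (λ xs ys → Decreasing xs → Decreasing ys → Decreasing (∪ₚ xs ys))
  (λ ys a b → b) (λ x xs a b → a)
  (λ x y xs ys y≤x ih → λ { (ha ∷ a) (hb ∷ b) → subst Decreasing (sym (∪ₚ-≥ xs ys y≤x))
      (All-∪ₚ xs (y ∷ ys) ha (y≤x ∷ All.map (λ h → ℕP.≤-trans h y≤x) hb) ∷ ih a (hb ∷ b)) })
  (λ x y xs ys x<y ih → λ { (ha ∷ a) (hb ∷ b) → subst Decreasing (sym (∪ₚ-< xs ys x<y))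
      (All-∪ₚ (x ∷ xs) ys (ℕP.<⇒≤ x<y ∷ All.map (λ h → ℕP.≤-trans h (ℕP.<⇒≤ x<y)) ha) hb ∷ ih (ha ∷ a) b) })

sum-∪ₚ : ∀ xs ys → sum (∪ₚ xs ys) ≡ sum xs + sum ys
sum-∪ₚ = ∪ₚ-ind (λ xs ys → sum (∪ₚ xs ys) ≡ sum xs + sum ys)
  (λ ys → refl) (λ x xs → sym (ℕP.+-identityʳ _))
  (λ x y xs ys y≤x ih → trans (cong sum (∪ₚ-≥ xs ys y≤x)) (trans (cong (x +_) ih) (sym (ℕP.+-assoc x _ _))))
  (λ x y xs ys x<y ih → trans (cong sum (∪ₚ-< xs ys x<y)) (trans (cong (y +_) ih)
      (solve 4 (λ y x a b → y :+ (x :+ a :+ b) := x :+ a :+ (y :+ b)) refl y x (sum xs) (sum ys))))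
  where open +-*-Solver

mult-∪ₚ : ∀ i xs ys → mult i (∪ₚ xs ys) ≡ mult i xs + mult i ys
mult-∪ₚ i = ∪ₚ-ind (λ xs ys → mult i (∪ₚ xs ys) ≡ mult i xs + mult i ys)
  (λ ys → refl) (λ x xs → sym (ℕP.+-identityʳ _))
  (λ x y xs ys y≤x ih → trans (cong (mult i) (∪ₚ-≥ xs ys y≤x)) (trans (mult-∷ i x (∪ₚ xs (y ∷ ys))) (trans (cong (ind (x ≟ i) +_) ih)
     (trans (sym (ℕP.+-assoc (ind (x ≟ i)) _ _)) (cong (_+ mult i (y ∷ ys)) (sym (mult-∷ i x xs)))))))
  (λ x y xs ys x<y ih → trans (cong (mult i) (∪ₚ-< xs ys x<y)) (trans (mult-∷ i y (∪ₚ (x ∷ xs) ys)) (trans (cong (ind (y ≟ i) +_) ih)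
     (trans (solve 3 (λ a b c → a :+ (b :+ c) := b :+ (a :+ c)) refl (ind (y ≟ i)) (mult i (x ∷ xs)) (mult i ys)) (cong (mult i (x ∷ xs) +_) (sym (mult-∷ i y ys)))))))
  where open +-*-Solver


splits-All : ∀ {P : ℕ → Set} l {s} → s ∈ splits l → All P l → All P (proj₁ s) × All P (proj₂ s)
splits-All []      (here refl) [] = [] , []
splits-All (p ∷ l) s∈ (Pp ∷ Pl) with ∈-splits-∷⁻ {p} {l} s∈
... | t , t∈ , inj₁ refl = let Pβ , Pρ = splits-All l t∈ Pl in Pp ∷ Pβ , Pρ
... | t , t∈ , inj₂ refl = let Pβ , Pρ = splits-All l t∈ Pl in Pβ , Pp ∷ Pρ

splits-Decreasing : ∀ l {s} → s ∈ splits l → Decreasing l → Decreasing (proj₁ s) × Decreasing (proj₂ s)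
splits-Decreasing []      (here refl) [] = [] , []
splits-Decreasing (p ∷ l) s∈ (≤p ∷ dec) with ∈-splits-∷⁻ {p} {l} s∈
... | t , t∈ , inj₁ refl = let dβ , dρ = splits-Decreasing l t∈ dec in proj₁ (splits-All l t∈ ≤p) ∷ dβ , dρ
... | t , t∈ , inj₂ refl = let dβ , dρ = splits-Decreasing l t∈ dec in dβ , proj₂ (splits-All l t∈ ≤p) ∷ dρ

splits-sum : ∀ l {s} → s ∈ splits l → sum (proj₁ s) + sum (proj₂ s) ≡ sum l
splits-sum []      (here refl) = refl
splits-sum (p ∷ l) s∈ with ∈-splits-∷⁻ {p} {l} s∈
... | (β , ρ) , t∈ , inj₁ refl = trans (ℕP.+-assoc p _ _) (cong (p +_) (splits-sum l t∈))
... | (β , ρ) , t∈ , inj₂ refl =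
  trans (solve 3 (λ a p b → a :+ (p :+ b) := p :+ (a :+ b)) refl (sum β) p (sum ρ)) (cong (p +_) (splits-sum l t∈))
  where open +-*-Solver

splits-∪ₚ : ∀ l {s} → s ∈ splits l → Decreasing l → ∪ₚ (proj₁ s) (proj₂ s) ≡ l
splits-∪ₚ []      (here refl) _ = refl
splits-∪ₚ (p ∷ l) s∈ (≤p ∷ dec) with ∈-splits-∷⁻ {p} {l} s∈
... | (β , ρ) , t∈ , inj₁ refl = trans (∪ₚ-∷ˡ β ρ (proj₂ (splits-All l t∈ ≤p))) (cong (p ∷_) (splits-∪ₚ l t∈ dec))
... | (β , ρ) , t∈ , inj₂ refl =
  trans (∪ₚ-∷ʳ β ρ (proj₁ (splits-All l t∈ ≤p)) (proj₂ (splits-All l t∈ ≤p))) (cong (p ∷_) (splits-∪ₚ l t∈ dec))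

countPair : ListPair → List ListPair → ℕ
countPair = Counting.count _≟ᴾ_

count-map-injective : ∀ (f : ListPair → ListPair) → (∀ {x y} → f x ≡ f y → x ≡ y) →
                      ∀ x S → countPair (f x) (map f S) ≡ countPair x S
count-map-injective f f-inj x S = trans (ℕΣ.∑-map f S _) (ℕΣ.∑-cong S same)
  where
  same : ∀ y → ind (f x ≟ᴾ f y) ≡ ind (x ≟ᴾ y)
  same y with f x ≟ᴾ f y | x ≟ᴾ y
  ... | yes _   | yes _    = refl
  ... | no _    | no _     = refl
  ... | yes fx≡ | no x≢    = ⊥-elim (x≢ (f-inj fx≡))
  ... | no fx≢  | yes refl = ⊥-elim (fx≢ refl)

count-map-missing : ∀ (f : ListPair → ListPair) e → (∀ x → f x ≢ e) → ∀ S → countPair e (map f S) ≡ 0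
count-map-missing f e f≢e S = trans (ℕΣ.∑-map f S _) (trans (ℕΣ.∑-cong S (λ y → ind-no (e ≟ᴾ f y) (f≢e y ∘ sym))) (ℕΣ.∑-zero S))

consˡ-injective : ∀ {p x y} → consˡ p x ≡ consˡ p y → x ≡ y
consˡ-injective eq = cong₂ _,_ (LP.∷-injectiveʳ (cong proj₁ eq)) (cong proj₂ eq)

consʳ-injective : ∀ {p x y} → consʳ p x ≡ consʳ p y → x ≡ y
consʳ-injective eq = cong₂ _,_ (cong proj₁ eq) (LP.∷-injectiveʳ (cong proj₂ eq))

count-splits-∷ : ∀ p l e → countPair e (splits (p ∷ l)) ≡
                 countPair e (map (consˡ p) (splits l)) + countPair e (map (consʳ p) (splits l))
count-splits-∷ p l e = ℕΣ.∑-++ (map (consˡ p) (splits l)) _ _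

count-splits-[]ˡ : ∀ β → countPair ([] , β) (splits β) ≡ 1
count-splits-[]ˡ []      = refl
count-splits-[]ˡ (p ∷ β) = trans (count-splits-∷ p β ([] , p ∷ β))
  (cong₂ _+_ (count-map-missing (consˡ p) ([] , p ∷ β) (λ _ ()) (splits β))
             (trans (count-map-injective (consʳ p) consʳ-injective ([] , β) (splits β)) (count-splits-[]ˡ β)))

count-splits-[]ʳ : ∀ α → countPair (α , []) (splits α) ≡ 1
count-splits-[]ʳ []      = refl
count-splits-[]ʳ (p ∷ α) = trans (count-splits-∷ p α (p ∷ α , []))
  (trans (cong₂ _+_ (trans (count-map-injective (consˡ p) consˡ-injective (α , []) (splits α)) (count-splits-[]ʳ α))
                    (count-map-missing (consʳ p) (p ∷ α , []) (λ _ ()) (splits α)))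
         refl)

count-splits-≢ : ∀ l e → Decreasing l → ∪ₚ (proj₁ e) (proj₂ e) ≢ l → countPair e (splits l) ≡ 0
count-splits-≢ l e dec ∪≢l = trans (ℕΣ.∑-cong-∈ (splits l) not-e) (ℕΣ.∑-zero (splits l))
  where
  not-e : ∀ {x} → x ∈ splits l → ind (e ≟ᴾ x) ≡ 0
  not-e x∈ = ind-no (e ≟ᴾ _) (λ { refl → ∪≢l (splits-∪ₚ l x∈ dec) })

splitCount : List ℕ → List ℕ → ℕ
splitCount α β = countPair (α , β) (splits (∪ₚ α β))

private
  mult-∪ₚ-absentʳ : ∀ {p} α β → All (_< p) β → mult p (∪ₚ α β) ≡ mult p α
  mult-∪ₚ-absentʳ {p} α β β<p = trans (mult-∪ₚ p α β) (trans (cong (mult p α +_) (mult-all< p β β<p)) (ℕP.+-identityʳ _))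

  mult-∪ₚ-absentˡ : ∀ {p} α β → All (_< p) α → mult p (∪ₚ α β) ≡ mult p β
  mult-∪ₚ-absentˡ {p} α β α<p = trans (mult-∪ₚ p α β) (cong (_+ mult p β) (mult-all< p α α<p))

  All<-∷ : ∀ {q p} β → q < p → All (_≤ q) β → All (_< p) (q ∷ β)
  All<-∷ β q<p ≤q = q<p ∷ All.map (λ y≤q → ℕP.≤-<-trans y≤q q<p) ≤q

  z-stepˡ : ∀ {p} n α β {Z} → 1 ≤ p → n * z α * z β ≡ Z → n * z (p ∷ α) * z β ≡ p * suc (mult p α) * Z
  z-stepˡ {p} n α β 1≤p IH = begin
    n * z (p ∷ α) * z β                   ≡⟨ cong (λ t → n * t * z β) (z-∷ p α 1≤p) ⟩
    n * (p * suc (mult p α) * z α) * z β  ≡⟨ solve 4 (λ n c a b → n :* (c :* a) :* b := c :* (n :* a :* b)) refl n (p * suc (mult p α)) (z α) (z β) ⟩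
    p * suc (mult p α) * (n * z α * z β)  ≡⟨ cong (p * suc (mult p α) *_) IH ⟩
    p * suc (mult p α) * _                ∎
    where
    open ≡-Reasoning
    open +-*-Solver

  z-stepʳ : ∀ {q} n α β {Z} → 1 ≤ q → n * z α * z β ≡ Z → n * z α * z (q ∷ β) ≡ q * suc (mult q β) * Z
  z-stepʳ {q} n α β 1≤q IH = begin
    n * z α * z (q ∷ β)                   ≡⟨ cong (n * z α *_) (z-∷ q β 1≤q) ⟩
    n * z α * (q * suc (mult q β) * z β)  ≡⟨ solve 4 (λ n a c b → n :* a :* (c :* b) := c :* (n :* a :* b)) refl n (z α) (q * suc (mult q β)) (z β) ⟩
    q * suc (mult q β) * (n * z α * z β)  ≡⟨ cong (q * suc (mult q β) *_) IH ⟩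
    q * suc (mult q β) * _                ∎
    where
    open ≡-Reasoning
    open +-*-Solver

  z-∷-via : ∀ {p m} λ′ → 1 ≤ p → mult p λ′ ≡ m → p * suc m * z λ′ ≡ z (p ∷ λ′)
  z-∷-via {p} λ′ 1≤p refl = sym (z-∷ p λ′ 1≤p)

  splitCount-> : ∀ {p q} α β → q < p → 1 ≤ p → All (_≤ q) β →
                 splitCount α (q ∷ β) * z α * z (q ∷ β) ≡ z (∪ₚ α (q ∷ β)) →
                 splitCount (p ∷ α) (q ∷ β) * z (p ∷ α) * z (q ∷ β) ≡ z (∪ₚ (p ∷ α) (q ∷ β))
  splitCount-> {p} {q} α β q<p 1≤p ≤q IH = begin
    splitCount (p ∷ α) (q ∷ β) * z (p ∷ α) * z (q ∷ β) ≡⟨ cong (λ n → n * z (p ∷ α) * z (q ∷ β)) same-count ⟩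
    splitCount α (q ∷ β) * z (p ∷ α) * z (q ∷ β)       ≡⟨ z-stepˡ (splitCount α (q ∷ β)) α (q ∷ β) 1≤p IH ⟩
    p * suc (mult p α) * z λ′                          ≡⟨ z-∷-via λ′ 1≤p (mult-∪ₚ-absentʳ α (q ∷ β) (All<-∷ β q<p ≤q)) ⟩
    z (p ∷ λ′)                                         ≡⟨ cong z merged ⟨
    z (∪ₚ (p ∷ α) (q ∷ β))                             ∎
    where
    open ≡-Reasoning
    λ′ = ∪ₚ α (q ∷ β)
    merged = ∪ₚ-≥ α β (ℕP.<⇒≤ q<p)
    same-count : splitCount (p ∷ α) (q ∷ β) ≡ splitCount α (q ∷ β)
    same-count = trans (cong (countPair (p ∷ α , q ∷ β) ∘ splits) merged) (trans (count-splits-∷ p λ′ (p ∷ α , q ∷ β))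
      (trans (cong₂ _+_ (count-map-injective (consˡ p) consˡ-injective (α , q ∷ β) (splits λ′))
                        (count-map-missing (consʳ p) (p ∷ α , q ∷ β) (λ _ eq → ℕP.<-irrefl (sym (LP.∷-injectiveˡ (cong proj₂ eq))) q<p) (splits λ′)))
             (ℕP.+-identityʳ _)))

  splitCount-< : ∀ {p q} α β → p < q → 1 ≤ q → All (_≤ p) α →
                 splitCount (p ∷ α) β * z (p ∷ α) * z β ≡ z (∪ₚ (p ∷ α) β) →
                 splitCount (p ∷ α) (q ∷ β) * z (p ∷ α) * z (q ∷ β) ≡ z (∪ₚ (p ∷ α) (q ∷ β))
  splitCount-< {p} {q} α β p<q 1≤q ≤p IH = begin
    splitCount (p ∷ α) (q ∷ β) * z (p ∷ α) * z (q ∷ β) ≡⟨ cong (λ n → n * z (p ∷ α) * z (q ∷ β)) same-count ⟩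
    splitCount (p ∷ α) β * z (p ∷ α) * z (q ∷ β)       ≡⟨ z-stepʳ (splitCount (p ∷ α) β) (p ∷ α) β 1≤q IH ⟩
    q * suc (mult q β) * z λ′                          ≡⟨ z-∷-via λ′ 1≤q (mult-∪ₚ-absentˡ (p ∷ α) β (All<-∷ α p<q ≤p)) ⟩
    z (q ∷ λ′)                                         ≡⟨ cong z merged ⟨
    z (∪ₚ (p ∷ α) (q ∷ β))                             ∎
    where
    open ≡-Reasoning
    λ′ = ∪ₚ (p ∷ α) β
    merged = ∪ₚ-< α β p<q
    same-count : splitCount (p ∷ α) (q ∷ β) ≡ splitCount (p ∷ α) β
    same-count = trans (cong (countPair (p ∷ α , q ∷ β) ∘ splits) merged) (trans (count-splits-∷ q λ′ (p ∷ α , q ∷ β))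
      (cong₂ _+_ (count-map-missing (consˡ q) (p ∷ α , q ∷ β) (λ _ eq → ℕP.<-irrefl (sym (LP.∷-injectiveˡ (cong proj₁ eq))) p<q) (splits λ′))
                 (count-map-injective (consʳ q) consʳ-injective (p ∷ α , β) (splits λ′))))

  splitCount-≡ : ∀ {p} α β → 1 ≤ p → All (_≤ p) α → All (_≤ p) β →
                 splitCount α (p ∷ β) * z α * z (p ∷ β) ≡ z (∪ₚ α (p ∷ β)) →
                 splitCount (p ∷ α) β * z (p ∷ α) * z β ≡ z (∪ₚ (p ∷ α) β) →
                 splitCount (p ∷ α) (p ∷ β) * z (p ∷ α) * z (p ∷ β) ≡ z (∪ₚ (p ∷ α) (p ∷ β))
  splitCount-≡ {p} α β 1≤p ≤pα ≤pβ IHˡ IHʳ = begin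
    splitCount (p ∷ α) (p ∷ β) * z (p ∷ α) * z (p ∷ β)
      ≡⟨ cong (λ n → n * z (p ∷ α) * z (p ∷ β)) split-count ⟩
    (Nˡ + Nʳ) * z (p ∷ α) * z (p ∷ β)
      ≡⟨ solve 4 (λ a b x y → (a :+ b) :* x :* y := a :* x :* y :+ b :* x :* y) refl Nˡ Nʳ (z (p ∷ α)) (z (p ∷ β)) ⟩
    Nˡ * z (p ∷ α) * z (p ∷ β) + Nʳ * z (p ∷ α) * z (p ∷ β)
      ≡⟨ cong₂ _+_ (z-stepˡ Nˡ α (p ∷ β) 1≤p IHˡ) (z-stepʳ Nʳ (p ∷ α) β 1≤p (trans IHʳ (cong z same-∪))) ⟩
    p * suc (mult p α) * z λ′ + p * suc (mult p β) * z λ′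
      ≡⟨ solve 4 (λ p a b w → p :* (con 1 :+ a) :* w :+ p :* (con 1 :+ b) :* w := p :* (con 1 :+ (a :+ (con 1 :+ b))) :* w) refl p (mult p α) (mult p β) (z λ′) ⟩
    p * suc (mult p α + suc (mult p β)) * z λ′
      ≡⟨ z-∷-via λ′ 1≤p (trans (mult-∪ₚ p α (p ∷ β)) (cong (mult p α +_) (mult-∷-≡ p β))) ⟩
    z (p ∷ λ′)
      ≡⟨ cong z merged ⟨
    z (∪ₚ (p ∷ α) (p ∷ β)) ∎
    where
    open ≡-Reasoning
    open +-*-Solver
    λ′ = ∪ₚ α (p ∷ β)
    Nˡ = splitCount α (p ∷ β)
    Nʳ = splitCount (p ∷ α) β
    merged = ∪ₚ-≥ α β (ℕP.≤-refl {p})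
    same-∪ : ∪ₚ (p ∷ α) β ≡ λ′
    same-∪ = trans (∪ₚ-∷ˡ α β ≤pβ) (sym (∪ₚ-∷ʳ α β ≤pα ≤pβ))
    split-count : splitCount (p ∷ α) (p ∷ β) ≡ Nˡ + Nʳ
    split-count = trans (cong (countPair (p ∷ α , p ∷ β) ∘ splits) merged) (trans (count-splits-∷ p λ′ (p ∷ α , p ∷ β))
      (cong₂ _+_ (count-map-injective (consˡ p) consˡ-injective (α , p ∷ β) (splits λ′))
                 (trans (count-map-injective (consʳ p) consʳ-injective (p ∷ α , β) (splits λ′))
                        (cong (countPair (p ∷ α , β) ∘ splits) (sym same-∪)))))

splitCount-z : ∀ α β → Decreasing α → Decreasing β → Positive α → Positive β →
               splitCount α β * z α * z β ≡ z (∪ₚ α β)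
splitCount-z []      β  _ _ _ _ = trans (cong (λ c → c * 1 * z β) (count-splits-[]ˡ β)) (ℕP.+-identityʳ (z β))
splitCount-z (p ∷ α) β₀ (≤p ∷ dα) dβ₀ (1≤p ∷ pα) pβ₀ = splitCount-z-∷ β₀ dβ₀ pβ₀
  where
  splitCount-z-∷ : ∀ β → Decreasing β → Positive β → splitCount (p ∷ α) β * z (p ∷ α) * z β ≡ z (∪ₚ (p ∷ α) β)
  splitCount-z-∷ [] _ _ =
    trans (cong (λ c → c * z (p ∷ α) * 1) (count-splits-[]ʳ (p ∷ α))) (trans (ℕP.*-identityʳ _) (ℕP.+-identityʳ _))
  splitCount-z-∷ (q ∷ β) (≤q ∷ dβ) (1≤q ∷ pβ) with ℕP.<-cmp q p
  ... | tri< q<p _ _ = splitCount-> α β q<p 1≤p ≤q (splitCount-z α (q ∷ β) dα (≤q ∷ dβ) pα (1≤q ∷ pβ))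
  ... | tri> _ _ p<q = splitCount-< α β p<q 1≤q ≤p (splitCount-z-∷ β dβ pβ)
  ... | tri≈ _ refl _ = splitCount-≡ α β 1≤p ≤p ≤q
    (splitCount-z α (q ∷ β) dα (≤q ∷ dβ) pα (1≤q ∷ pβ)) (splitCount-z-∷ β dβ pβ)

-- Sums over partitions weighted by 1/z_λ

pairsOfTotal : {X : Set} → (ℕ → List X) → ℕ → List (X × X)
pairsOfTotal A n = concatMap (λ c → concatMap (λ a → map (a ,_) (A (n ∸ c))) (A c)) (upTo (suc n))

module PairsOfTotal {X : Set} (A : ℕ → List X) (size : X → ℕ)
                    (size-A : ∀ {m y} → y ∈ A m → size y ≡ m) (A-unique : ∀ m → Unique (A m)) where

  private
    row : ℕ → ℕ → List (X × X)
    row n c = concatMap (λ a → map (a ,_) (A (n ∸ c))) (A c)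

  pairsOfTotal-unique : ∀ n → Unique (pairsOfTotal A n)
  pairsOfTotal-unique n = Unique-concatMap⁺ (row n) (UniqueP.upTo⁺ (suc n))
    (λ c → Unique-concatMap⁺ (λ a → map (a ,_) (A (n ∸ c))) (A-unique c)
             (λ a → UniqueP.map⁺ (cong proj₂) (A-unique (n ∸ c))) (same-first c))
    same-row
    where
    same-first : ∀ c {a a′ x} → x ∈ map (a ,_) (A (n ∸ c)) → x ∈ map (a′ ,_) (A (n ∸ c)) → a ≡ a′
    same-first c {a} {a′} x∈ x∈′ with ∈-map⁻ (a ,_) x∈ | ∈-map⁻ (a′ ,_) x∈′
    ... | _ , _ , refl | _ , _ , eq = cong proj₁ eq
    same-row : ∀ {c c′ x} → x ∈ row n c → x ∈ row n c′ → c ≡ c′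
    same-row {c} {c′} x∈ x∈′ with ∈-concatMap⁻′ (λ a → map (a ,_) (A (n ∸ c))) (A c) x∈
                                | ∈-concatMap⁻′ (λ a → map (a ,_) (A (n ∸ c′))) (A c′) x∈′
    ... | a , a∈ , x∈₁ | a′ , a′∈ , x∈₂ with ∈-map⁻ (a ,_) x∈₁ | ∈-map⁻ (a′ ,_) x∈₂
    ... | _ , _ , refl | _ , _ , eq = trans (sym (size-A a∈)) (trans (cong (size ∘ proj₁) eq) (size-A a′∈))

  ∈-pairsOfTotal⁺ : ∀ n {c a b} → c ≤ n → a ∈ A c → b ∈ A (n ∸ c) → (a , b) ∈ pairsOfTotal A n
  ∈-pairsOfTotal⁺ n {c} {a} c≤n a∈ b∈ =
    ∈-concatMap⁺′ (row n) (∈-upTo⁺ (s≤s c≤n)) (∈-concatMap⁺′ (λ a → map (a ,_) (A (n ∸ c))) a∈ (∈-map⁺ (a ,_) b∈))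

  ∈-pairsOfTotal⁻ : ∀ n {e} → e ∈ pairsOfTotal A n → Σ ℕ λ c → c ≤ n × proj₁ e ∈ A c × proj₂ e ∈ A (n ∸ c)
  ∈-pairsOfTotal⁻ n e∈ with ∈-concatMap⁻′ (row n) (upTo (suc n)) e∈
  ... | c , c∈ , e∈′ with ∈-concatMap⁻′ (λ a → map (a ,_) (A (n ∸ c))) (A c) e∈′
  ... | a , a∈ , e∈″ with ∈-map⁻ (a ,_) e∈″
  ... | b , b∈ , refl = c , ℕP.≤-pred (∈-upTo⁻ c∈) , a∈ , b∈

  ∈-pairsOfTotal-size : ∀ n {a b} → (a , b) ∈ pairsOfTotal A n → size a + size b ≡ n
  ∈-pairsOfTotal-size n e∈ with ∈-pairsOfTotal⁻ n e∈
  ... | c , c≤n , a∈ , b∈ = trans (cong₂ _+_ (size-A a∈) (size-A b∈)) (ℕP.m+[n∸m]≡n c≤n)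

  module _ {c ℓ} (R : CommutativeSemiring c ℓ) where
    open CommutativeSemiring R using (Carrier; _≈_) renaming (trans to ≈-trans)
    open ListSum R

    ∑-pairsOfTotal : ∀ n (f : X × X → Carrier) →
      ∑ (pairsOfTotal A n) f ≈ ∑ (upTo (suc n)) (λ c → ∑ (A c) (λ a → ∑ (A (n ∸ c)) (λ b → f (a , b))))
    ∑-pairsOfTotal n f = ≈-trans (∑-concatMap (row n) (upTo (suc n)) f) (∑-cong (upTo (suc n)) (λ c →
      ≈-trans (∑-concatMap (λ a → map (a ,_) (A (n ∸ c))) (A c) f) (∑-cong (A c) (λ a → ∑-map (a ,_) (A (n ∸ c)) f))))
open PairsOfTotal Partitions sum sum-Partitions Partitions-unique

pairsOfPartitions-sound : ∀ n {α β} → (α , β) ∈ (pairsOfTotal Partitions n) →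
                       IsPartition (sum α) α × IsPartition (sum β) β
pairsOfPartitions-sound n αβ∈ =
  let c , _ , α∈ , β∈ = ∈-pairsOfTotal⁻ n αβ∈
      dα , pα , _ = Partitions-sound {c} α∈
      dβ , pβ , _ = Partitions-sound {n ∸ c} β∈
  in (dα , pα , refl) , (dβ , pβ , refl)

splits⊆pairsOfPartitions : ∀ {n l s} → l ∈ Partitions n → s ∈ splits l → s ∈ (pairsOfTotal Partitions n)
splits⊆pairsOfPartitions {n} {l} {β , ρ} l∈ s∈ =
  ∈-pairsOfTotal⁺ n {sum β} {β} {ρ} β≤n
    (Partitions-complete {sum β} {β} (dβ , pβ , refl))
    (Partitions-complete {n ∸ sum β} {ρ} (dρ , pρ , Σρ))
  where
  isP = Partitions-sound {n} l∈
  Σβρ : sum β + sum ρ ≡ n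
  Σβρ = trans (splits-sum l s∈) (proj₂ (proj₂ isP))
  β≤n : sum β ≤ n
  β≤n = subst (sum β ≤_) Σβρ (ℕP.m≤m+n (sum β) (sum ρ))
  Σρ : sum ρ ≡ n ∸ sum β
  Σρ = sym (trans (cong (_∸ sum β) (sym Σβρ)) (ℕP.m+n∸m≡n (sum β) (sum ρ)))
  dβ = proj₁ (splits-Decreasing l s∈ (proj₁ isP))
  dρ = proj₂ (splits-Decreasing l s∈ (proj₁ isP))
  pβ = proj₁ (splits-All l s∈ (proj₁ (proj₂ isP)))
  pρ = proj₂ (splits-All l s∈ (proj₁ (proj₂ isP)))

∪ₚ-pairsOfPartitions : ∀ n {α β} → (α , β) ∈ (pairsOfTotal Partitions n) → ∪ₚ α β ∈ Partitions n
∪ₚ-pairsOfPartitions n {α} {β} αβ∈ =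
  let (dα , pα , _) , (dβ , pβ , _) = pairsOfPartitions-sound n αβ∈
  in Partitions-complete {n} {∪ₚ α β}
       (Decreasing-∪ₚ α β dα dβ , All-∪ₚ α β pα pβ , trans (sum-∪ₚ α β) (∈-pairsOfTotal-size n αβ∈))
private
  recip-*-fromℕ : ∀ n a b c → n * a * b ≡ c → 1 ≤ a → 1 ≤ b → 1 ≤ c →
                  recip c ℚ.* fromℕ n ≡ recip a ℚ.* recip b
  recip-*-fromℕ n a b c eq 1≤a 1≤b 1≤c = begin
    recip c ℚ.* fromℕ n                             ≡⟨ cong (recip c ℚ.*_) (fromℕ-as-quotient n a b c eq 1≤a 1≤b) ⟩
    recip c ℚ.* (fromℕ c ℚ.* (recip a ℚ.* recip b))  ≡⟨ ℚP.*-assoc (recip c) _ _ ⟨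
    recip c ℚ.* fromℕ c ℚ.* (recip a ℚ.* recip b)    ≡⟨ cong (ℚ._* (recip a ℚ.* recip b)) (recip-inverse c 1≤c) ⟩
    1ℚ ℚ.* (recip a ℚ.* recip b)                     ≡⟨ ℚP.*-identityˡ _ ⟩
    recip a ℚ.* recip b                              ∎
    where open ≡-Reasoning

-- only λ = α ∪ β contributes, with count splitCount α β = z (α ∪ β) / (z α z β)
∑-countPair-splits : ∀ n {α β} → (α , β) ∈ (pairsOfTotal Partitions n) →
  ℚΣ.∑ (Partitions n) (λ l → recip (z l) ℚ.* fromℕ (countPair (α , β) (splits l))) ≡ recip (z α) ℚ.* recip (z β)
∑-countPair-splits n {α} {β} αβ∈ = begin
  ℚΣ.∑ (Partitions n) f
    ≡⟨ ℚΣ.∑-supported-at f (Partitions-unique n) (∪ₚ-pairsOfPartitions n αβ∈) vanish ⟩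
  f (∪ₚ α β)
    ≡⟨ recip-*-fromℕ (countPair (α , β) (splits (∪ₚ α β))) (z α) (z β) (z (∪ₚ α β))
         (splitCount-z α β dα dβ pα pβ) (z-positive α pα) (z-positive β pβ) (z-positive (∪ₚ α β) (All-∪ₚ α β pα pβ)) ⟩
  recip (z α) ℚ.* recip (z β) ∎
  where
  open ≡-Reasoning
  f : List ℕ → ℚ
  f l = recip (z l) ℚ.* fromℕ (countPair (α , β) (splits l))
  isPα = proj₁ (pairsOfPartitions-sound n αβ∈)
  isPβ = proj₂ (pairsOfPartitions-sound n αβ∈)
  dα = proj₁ isPα
  pα = proj₁ (proj₂ isPα)
  dβ = proj₁ isPβ
  pβ = proj₁ (proj₂ isPβ)
  vanish : ∀ {l} → l ∈ Partitions n → l ≢ ∪ₚ α β → f l ≡ 0ℚ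
  vanish {l} l∈ l≢ = trans (cong (λ t → recip (z l) ℚ.* fromℕ t)
                             (count-splits-≢ l (α , β) (proj₁ (Partitions-sound {n} l∈)) (l≢ ∘ sym)))
                           (ℚP.*-zeroʳ (recip (z l)))

∑-splits-Partitions : ∀ n (F : List ℕ → List ℕ → ℕ) →
  ℚΣ.∑ (Partitions n) (λ l → recip (z l) ℚ.* fromℕ (∑-splits l F)) ≡
  ℚΣ.∑ (pairsOfTotal Partitions n) (λ e → recip (z (proj₁ e)) ℚ.* recip (z (proj₂ e)) ℚ.* fromℕ (F (proj₁ e) (proj₂ e)))
∑-splits-Partitions n F = begin
  ℚΣ.∑ (Partitions n) (λ l → recip (z l) ℚ.* fromℕ (∑-splits l F))
    ≡⟨ ℚΣ.∑-cong-∈ (Partitions n) (λ {l} l∈ → cong (λ t → recip (z l) ℚ.* fromℕ t) (grouped l∈)) ⟩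
  ℚΣ.∑ (Partitions n) (λ l → recip (z l) ℚ.* fromℕ (ℕΣ.∑ (pairsOfTotal Partitions n) (λ e → countPair e (splits l) * F (proj₁ e) (proj₂ e))))
    ≡⟨ ℚΣ.∑-cong (Partitions n) expand ⟩
  ℚΣ.∑ (Partitions n) (λ l → ℚΣ.∑ (pairsOfTotal Partitions n) (λ e → term l e))
    ≡⟨ ℚΣ.∑-comm (Partitions n) (pairsOfTotal Partitions n) term ⟩
  ℚΣ.∑ (pairsOfTotal Partitions n) (λ e → ℚΣ.∑ (Partitions n) (λ l → term l e))
    ≡⟨ ℚΣ.∑-cong-∈ (pairsOfTotal Partitions n) collapse ⟩
  ℚΣ.∑ (pairsOfTotal Partitions n) (λ e → recip (z (proj₁ e)) ℚ.* recip (z (proj₂ e)) ℚ.* fromℕ (F (proj₁ e) (proj₂ e))) ∎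
  where
  open ≡-Reasoning
  term : List ℕ → ListPair → ℚ
  term l e = recip (z l) ℚ.* fromℕ (countPair e (splits l)) ℚ.* fromℕ (F (proj₁ e) (proj₂ e))
  grouped : ∀ {l} → l ∈ Partitions n →
            ∑-splits l F ≡ ℕΣ.∑ (pairsOfTotal Partitions n) (λ e → countPair e (splits l) * F (proj₁ e) (proj₂ e))
  grouped {l} l∈ = Counting.∑-group _≟ᴾ_ (splits l) (λ e → F (proj₁ e) (proj₂ e))
                     (pairsOfTotal-unique n) (All.tabulate (splits⊆pairsOfPartitions {n} l∈))
  expand : ∀ l → recip (z l) ℚ.* fromℕ (ℕΣ.∑ (pairsOfTotal Partitions n) (λ e → countPair e (splits l) * F (proj₁ e) (proj₂ e))) ≡
                 ℚΣ.∑ (pairsOfTotal Partitions n) (λ e → term l e)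
  expand l = begin
    recip (z l) ℚ.* fromℕ (ℕΣ.∑ (pairsOfTotal Partitions n) (λ e → countPair e (splits l) * F (proj₁ e) (proj₂ e)))
      ≡⟨ cong (recip (z l) ℚ.*_) (∑-fromℕ (pairsOfTotal Partitions n) (λ e → countPair e (splits l) * F (proj₁ e) (proj₂ e))) ⟨
    recip (z l) ℚ.* ℚΣ.∑ (pairsOfTotal Partitions n) (λ e → fromℕ (countPair e (splits l) * F (proj₁ e) (proj₂ e)))
      ≡⟨ ℚΣ.∑-distribˡ (pairsOfTotal Partitions n) (recip (z l)) (λ e → fromℕ (countPair e (splits l) * F (proj₁ e) (proj₂ e))) ⟨
    ℚΣ.∑ (pairsOfTotal Partitions n) (λ e → recip (z l) ℚ.* fromℕ (countPair e (splits l) * F (proj₁ e) (proj₂ e)))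
      ≡⟨ ℚΣ.∑-cong (pairsOfTotal Partitions n) (λ e → trans
           (cong (recip (z l) ℚ.*_) (fromℕ-* (countPair e (splits l)) (F (proj₁ e) (proj₂ e))))
           (sym (ℚP.*-assoc (recip (z l)) (fromℕ (countPair e (splits l))) (fromℕ (F (proj₁ e) (proj₂ e)))))) ⟩
    ℚΣ.∑ (pairsOfTotal Partitions n) (λ e → term l e) ∎
  collapse : ∀ {e} → e ∈ pairsOfTotal Partitions n →
             ℚΣ.∑ (Partitions n) (λ l → term l e) ≡ recip (z (proj₁ e)) ℚ.* recip (z (proj₂ e)) ℚ.* fromℕ (F (proj₁ e) (proj₂ e))
  collapse {e} e∈ = begin
    ℚΣ.∑ (Partitions n) (λ l → term l e)
      ≡⟨ ℚΣ.∑-distribʳ (Partitions n) (fromℕ (F (proj₁ e) (proj₂ e))) (λ l → recip (z l) ℚ.* fromℕ (countPair e (splits l))) ⟩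
    ℚΣ.∑ (Partitions n) (λ l → recip (z l) ℚ.* fromℕ (countPair e (splits l))) ℚ.* fromℕ (F (proj₁ e) (proj₂ e))
      ≡⟨ cong (ℚ._* fromℕ (F (proj₁ e) (proj₂ e))) (∑-countPair-splits n e∈) ⟩
    recip (z (proj₁ e)) ℚ.* recip (z (proj₂ e)) ℚ.* fromℕ (F (proj₁ e) (proj₂ e)) ∎

∑/z : ℕ → (List ℕ → ℕ) → ℚ
∑/z n F = ℚΣ.∑ (Partitions n) (λ l → recip (z l) ℚ.* fromℕ (F l))

∑-splits-product : ∀ n (F G : List ℕ → ℕ) →
  ∑/z n (λ l → ∑-splits l (λ β ρ → F β * G ρ)) ≡ ℚΣ.∑ (upTo (suc n)) (λ c → ∑/z c F ℚ.* ∑/z (n ∸ c) G)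
∑-splits-product n F G = begin
  ∑/z n (λ l → ∑-splits l (λ β ρ → F β * G ρ))
    ≡⟨ ∑-splits-Partitions n (λ β ρ → F β * G ρ) ⟩
  ℚΣ.∑ (pairsOfTotal Partitions n) (λ e → recip (z (proj₁ e)) ℚ.* recip (z (proj₂ e)) ℚ.* fromℕ (F (proj₁ e) * G (proj₂ e)))
    ≡⟨ ∑-pairsOfTotal ℚ-commutativeSemiring n (λ e → recip (z (proj₁ e)) ℚ.* recip (z (proj₂ e)) ℚ.* fromℕ (F (proj₁ e) * G (proj₂ e))) ⟩
  ℚΣ.∑ (upTo (suc n)) (λ c → ℚΣ.∑ (Partitions c) (λ α → ℚΣ.∑ (Partitions (n ∸ c)) (λ β →
    recip (z α) ℚ.* recip (z β) ℚ.* fromℕ (F α * G β))))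
    ≡⟨ ℚΣ.∑-cong (upTo (suc n)) factorise ⟩
  ℚΣ.∑ (upTo (suc n)) (λ c → ∑/z c F ℚ.* ∑/z (n ∸ c) G) ∎
  where
  open ≡-Reasoning
  open ℚSolver.+-*-Solver
  rearrange : ∀ α β → recip (z α) ℚ.* recip (z β) ℚ.* fromℕ (F α * G β) ≡
                      (recip (z α) ℚ.* fromℕ (F α)) ℚ.* (recip (z β) ℚ.* fromℕ (G β))
  rearrange α β = trans (cong (recip (z α) ℚ.* recip (z β) ℚ.*_) (fromℕ-* (F α) (G β)))
    (solve 4 (λ a b f g → a :* b :* (f :* g) := (a :* f) :* (b :* g)) refl (recip (z α)) (recip (z β)) (fromℕ (F α)) (fromℕ (G β)))
  factorise : ∀ c → ℚΣ.∑ (Partitions c) (λ α → ℚΣ.∑ (Partitions (n ∸ c)) (λ β →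
                      recip (z α) ℚ.* recip (z β) ℚ.* fromℕ (F α * G β))) ≡ ∑/z c F ℚ.* ∑/z (n ∸ c) G
  factorise c = begin
    ℚΣ.∑ (Partitions c) (λ α → ℚΣ.∑ (Partitions (n ∸ c)) (λ β → recip (z α) ℚ.* recip (z β) ℚ.* fromℕ (F α * G β)))
      ≡⟨ ℚΣ.∑-cong (Partitions c) (λ α → ℚΣ.∑-cong (Partitions (n ∸ c)) (rearrange α)) ⟩
    ℚΣ.∑ (Partitions c) (λ α → ℚΣ.∑ (Partitions (n ∸ c)) (λ β → (recip (z α) ℚ.* fromℕ (F α)) ℚ.* (recip (z β) ℚ.* fromℕ (G β))))
      ≡⟨ ℚΣ.∑-cong (Partitions c) (λ α → ℚΣ.∑-distribˡ (Partitions (n ∸ c)) (recip (z α) ℚ.* fromℕ (F α)) (λ β → recip (z β) ℚ.* fromℕ (G β))) ⟩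
    ℚΣ.∑ (Partitions c) (λ α → (recip (z α) ℚ.* fromℕ (F α)) ℚ.* ∑/z (n ∸ c) G)
      ≡⟨ ℚΣ.∑-distribʳ (Partitions c) (∑/z (n ∸ c) G) (λ α → recip (z α) ℚ.* fromℕ (F α)) ⟩
    ∑/z c F ℚ.* ∑/z (n ∸ c) G ∎

∑-splits-first-empty : ∀ l (H : List ℕ → List ℕ → ℕ) → (∀ q β ρ → H (q ∷ β) ρ ≡ 0) → ∑-splits l H ≡ H [] l
∑-splits-first-empty []      H H≡0 = ℕP.+-identityʳ _
∑-splits-first-empty (p ∷ l) H H≡0 = begin
  ∑-splits (p ∷ l) H
    ≡⟨ ∑-splits-∷ p l H ⟩
  ∑-splits l (λ β ρ → H (p ∷ β) ρ) + ∑-splits l (λ β ρ → H β (p ∷ ρ))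
    ≡⟨ cong₂ _+_ (trans (∑-splits-cong l (H≡0 p)) (ℕΣ.∑-zero (splits l)))
                 (∑-splits-first-empty l (λ β ρ → H β (p ∷ ρ)) (λ q β ρ → H≡0 q β (p ∷ ρ))) ⟩
  H [] (p ∷ l) ∎
  where open ≡-Reasoning

singlePartSize : List ℕ → ℕ
singlePartSize β = ind (length β ≟ 1) * sum β

∑-splits-singlePartSize : ∀ l → ∑-splits l (λ β _ → singlePartSize β * 1) ≡ sum l
∑-splits-singlePartSize []      = refl
∑-splits-singlePartSize (p ∷ l) = trans (∑-splits-∷ p l _)
  (cong₂ _+_ (trans (∑-splits-first-empty l _ (λ _ _ _ → refl))
                    (trans (ℕP.*-identityʳ _) (trans (ℕP.+-identityʳ _) (ℕP.+-identityʳ p))))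
             (∑-splits-singlePartSize l))

private
  -- Z(n) = Σ_{λ ⊢ n} 1/z_λ: marking one of n points and recording the size c of its part, n Z(n) = Σ_{c ≥ 1} Z(n - c)
  ∑/z-const-1-recursion : ∀ n → ∑/z n (λ _ → 1) ℚ.* fromℕ n ≡ ℚΣ.∑ (upTo (suc n)) (λ c → ∑/z c singlePartSize ℚ.* ∑/z (n ∸ c) (λ _ → 1))
  ∑/z-const-1-recursion n = begin
    ∑/z n (λ _ → 1) ℚ.* fromℕ n
      ≡⟨ ℚΣ.∑-distribʳ (Partitions n) (fromℕ n) (λ l → recip (z l) ℚ.* fromℕ 1) ⟨
    ℚΣ.∑ (Partitions n) (λ l → recip (z l) ℚ.* fromℕ 1 ℚ.* fromℕ n)
      ≡⟨ ℚΣ.∑-cong-∈ (Partitions n) (λ {l} l∈ → begin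
           recip (z l) ℚ.* fromℕ 1 ℚ.* fromℕ n     ≡⟨ ℚP.*-assoc (recip (z l)) _ _ ⟩
           recip (z l) ℚ.* (fromℕ 1 ℚ.* fromℕ n)   ≡⟨ cong (recip (z l) ℚ.*_) (sym (fromℕ-* 1 n)) ⟩
           recip (z l) ℚ.* fromℕ (1 * n)           ≡⟨ cong (λ t → recip (z l) ℚ.* fromℕ t)
                                                        (trans (ℕP.*-identityˡ n) (trans (sym (sum-Partitions {n} l∈)) (sym (∑-splits-singlePartSize l)))) ⟩
           recip (z l) ℚ.* fromℕ (∑-splits l (λ β ρ → singlePartSize β * 1)) ∎) ⟩
    ∑/z n (λ l → ∑-splits l (λ β ρ → singlePartSize β * 1))
      ≡⟨ ∑-splits-product n singlePartSize (λ _ → 1) ⟩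
    ℚΣ.∑ (upTo (suc n)) (λ c → ∑/z c singlePartSize ℚ.* ∑/z (n ∸ c) (λ _ → 1)) ∎
    where open ≡-Reasoning

  ∑/z-singlePartSize : ∀ c → ∑/z (suc c) singlePartSize ≡ 1ℚ
  ∑/z-singlePartSize c =
    trans (ℚΣ.∑-supported-at (λ α → recip (z α) ℚ.* fromℕ (singlePartSize α)) (Partitions-unique (suc c)) single∈ vanish)
          (trans (cong₂ (λ u v → recip u ℚ.* fromℕ v) z-single (trans (ℕP.*-identityˡ (suc c + 0)) (ℕP.+-identityʳ (suc c))))
                 (recip-inverse (suc c) (s≤s z≤n)))
    where
    single∈ : suc c ∷ [] ∈ Partitions (suc c)
    single∈ = Partitions-complete ([] ∷ [] , s≤s z≤n ∷ [] , ℕP.+-identityʳ _)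
    z-single : z (suc c ∷ []) ≡ suc c
    z-single = trans (z-∷ (suc c) [] (s≤s z≤n)) (trans (ℕP.*-identityʳ (suc c * 1)) (ℕP.*-identityʳ (suc c)))
    vanish : ∀ {α} → α ∈ Partitions (suc c) → α ≢ suc c ∷ [] → recip (z α) ℚ.* fromℕ (singlePartSize α) ≡ 0ℚ
    vanish {[]}        _  _   = ℚP.*-zeroʳ (recip (z []))
    vanish {x ∷ []}    α∈ α≢ = ⊥-elim (α≢ (cong (_∷ []) (trans (sym (ℕP.+-identityʳ x)) (sum-Partitions {suc c} α∈))))
    vanish {x ∷ y ∷ α} _  _   = ℚP.*-zeroʳ (recip (z (x ∷ y ∷ α)))

  ∑/z-const-1-bounded : ∀ b n → n ≤ b → ∑/z n (λ _ → 1) ≡ 1ℚ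
  ∑/z-const-1-bounded b       zero    _         = refl
  ∑/z-const-1-bounded (suc b) (suc n) (s≤s n≤b) = begin
    ∑/z N (λ _ → 1)                                    ≡⟨ ℚP.*-identityʳ _ ⟨
    ∑/z N (λ _ → 1) ℚ.* 1ℚ                             ≡⟨ cong (∑/z N (λ _ → 1) ℚ.*_) N/N≡1 ⟨
    ∑/z N (λ _ → 1) ℚ.* (fromℕ N ℚ.* recip N)          ≡⟨ ℚP.*-assoc (∑/z N (λ _ → 1)) _ _ ⟨
    ∑/z N (λ _ → 1) ℚ.* fromℕ N ℚ.* recip N            ≡⟨ cong (ℚ._* recip N) (∑/z-const-1-recursion N) ⟩
    ℚΣ.∑ (upTo (suc N)) (λ c → ∑/z c singlePartSize ℚ.* ∑/z (N ∸ c) (λ _ → 1)) ℚ.* recip N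
                                                 ≡⟨ cong (ℚ._* recip N) terms ⟩
    fromℕ N ℚ.* recip N                          ≡⟨ N/N≡1 ⟩
    1ℚ                                           ∎
    where
    open ≡-Reasoning
    N = suc n
    N/N≡1 : fromℕ N ℚ.* recip N ≡ 1ℚ
    N/N≡1 = trans (ℚP.*-comm (fromℕ N) (recip N)) (recip-inverse N (s≤s z≤n))
    one-each : ∀ {c} → c ∈ applyUpTo suc N → ∑/z c singlePartSize ℚ.* ∑/z (N ∸ c) (λ _ → 1) ≡ fromℕ 1
    one-each c∈ with ∈-applyUpTo⁻ suc c∈
    ... | i , _ , refl = trans (cong₂ ℚ._*_ (∑/z-singlePartSize i) (∑/z-const-1-bounded b (n ∸ i) (ℕP.≤-trans (ℕP.m∸n≤m n i) n≤b)))
                               (ℚP.*-identityˡ 1ℚ)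
    terms : ℚΣ.∑ (upTo (suc N)) (λ c → ∑/z c singlePartSize ℚ.* ∑/z (N ∸ c) (λ _ → 1)) ≡ fromℕ N
    terms = begin
      ∑/z 0 singlePartSize ℚ.* ∑/z N (λ _ → 1) ℚ.+ ℚΣ.∑ (applyUpTo suc N) (λ c → ∑/z c singlePartSize ℚ.* ∑/z (N ∸ c) (λ _ → 1))
        ≡⟨ cong₂ ℚ._+_ (ℚP.*-zeroˡ (∑/z N (λ _ → 1))) (ℚΣ.∑-cong-∈ (applyUpTo suc N) one-each) ⟩
      0ℚ ℚ.+ ℚΣ.∑ (applyUpTo suc N) (λ _ → fromℕ 1)
        ≡⟨ trans (ℚP.+-identityˡ _) (∑-fromℕ (applyUpTo suc N) (λ _ → 1)) ⟩
      fromℕ (ℕΣ.∑ (applyUpTo suc N) (λ _ → 1))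
        ≡⟨ cong fromℕ (trans (∑-1≡length (applyUpTo suc N)) (LP.length-applyUpTo suc N)) ⟩
      fromℕ N ∎

∑/z-const-1 : ∀ n → ∑/z n (λ _ → 1) ≡ 1ℚ
∑/z-const-1 n = ∑/z-const-1-bounded n n ℕP.≤-refl

-- Colourings of the parts by the subsets of {1, …, k}

-- H summed over all colourings of the parts of l, a colour c adding the part p to the weight
∑-colourings : {W : Set} → W → List (ℕ → W → W) → List ℕ → (W → ℕ) → ℕ
∑-colourings w₀ cs []      H = H w₀
∑-colourings w₀ cs (p ∷ l) H = ℕΣ.∑ cs (λ c → ∑-colourings w₀ cs l (H ∘ c p))

module Colourings {W : Set} (w₀ : W) (cs : List (ℕ → W → W)) where

  private
    C : List ℕ → (W → ℕ) → ℕ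
    C = ∑-colourings w₀ cs

  ∑-colourings-cong : ∀ l {H K : W → ℕ} → (∀ w → H w ≡ K w) → C l H ≡ C l K
  ∑-colourings-cong []      H≡K = H≡K w₀
  ∑-colourings-cong (p ∷ l) H≡K = ℕΣ.∑-cong cs (λ c → ∑-colourings-cong l (H≡K ∘ c p))

  ∑-colourings-distrib-+ : ∀ l (H K : W → ℕ) → C l (λ w → H w + K w) ≡ C l H + C l K
  ∑-colourings-distrib-+ []      H K = refl
  ∑-colourings-distrib-+ (p ∷ l) H K = trans (ℕΣ.∑-cong cs (λ c → ∑-colourings-distrib-+ l (H ∘ c p) (K ∘ c p)))
                                              (ℕΣ.∑-distrib-+ cs _ _)

  ∑-colourings-zero : ∀ l → C l (λ _ → 0) ≡ 0
  ∑-colourings-zero []      = refl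
  ∑-colourings-zero (p ∷ l) = trans (ℕΣ.∑-cong cs (λ c → ∑-colourings-zero l)) (ℕΣ.∑-zero cs)

  ∑-colourings-distribˡ : ∀ l a (H : W → ℕ) → C l (λ w → a * H w) ≡ a * C l H
  ∑-colourings-distribˡ []      a H = refl
  ∑-colourings-distribˡ (p ∷ l) a H = trans (ℕΣ.∑-cong cs (λ c → ∑-colourings-distribˡ l a (H ∘ c p))) (ℕΣ.∑-distribˡ cs a _)

  ∑-colourings-distribʳ : ∀ l a (H : W → ℕ) → C l (λ w → H w * a) ≡ C l H * a
  ∑-colourings-distribʳ l a H =
    trans (∑-colourings-cong l (λ w → ℕP.*-comm (H w) a)) (trans (∑-colourings-distribˡ l a H) (ℕP.*-comm a (C l H)))

  ∑-colourings-∑ : ∀ l (xs : List A) (F : A → W → ℕ) → C l (λ w → ℕΣ.∑ xs (λ x → F x w)) ≡ ℕΣ.∑ xs (λ x → C l (F x))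
  ∑-colourings-∑ l []       F = ∑-colourings-zero l
  ∑-colourings-∑ l (x ∷ xs) F = trans (∑-colourings-distrib-+ l (F x) _) (cong (C l (F x) +_) (∑-colourings-∑ l xs F))

  module Support (total : W → ℕ) (total-w₀ : total w₀ ≡ 0) (total-c : All (λ c → ∀ p w → total (c p w) ≡ p + total w) cs) where

    ∑-colourings-cong-total : ∀ l {H K : W → ℕ} → (∀ w → total w ≡ sum l → H w ≡ K w) → C l H ≡ C l K
    ∑-colourings-cong-total []      H≡K = H≡K w₀ total-w₀
    ∑-colourings-cong-total (p ∷ l) H≡K = ℕΣ.∑-cong-∈ cs (λ c∈ →
      ∑-colourings-cong-total l (λ w tw → H≡K _ (trans (All.lookup total-c c∈ p w) (cong (p +_) tw))))

∑-splits-∑ : ∀ l (xs : List A) (F : A → List ℕ → List ℕ → ℕ) →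
             ∑-splits l (λ β ρ → ℕΣ.∑ xs (λ x → F x β ρ)) ≡ ℕΣ.∑ xs (λ x → ∑-splits l (F x))
∑-splits-∑ l xs F = ℕΣ.∑-comm (splits l) xs (λ s x → F x (proj₁ s) (proj₂ s))

∑-splits-distribʳ : ∀ l (F : List ℕ → List ℕ → ℕ) a → ∑-splits l (λ β ρ → F β ρ * a) ≡ ∑-splits l F * a
∑-splits-distribʳ l F a = ℕΣ.∑-distribʳ (splits l) a (λ s → F (proj₁ s) (proj₂ s))

∑-splits-*-∑ : ∀ l (xs : List A) (G : List ℕ → List ℕ → ℕ) (Y : A → List ℕ → List ℕ → ℕ) →
  ∑-splits l (λ β ρ → G β ρ * ℕΣ.∑ xs (λ x → Y x β ρ)) ≡ ℕΣ.∑ xs (λ x → ∑-splits l (λ β ρ → G β ρ * Y x β ρ))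
∑-splits-*-∑ l xs G Y =
  trans (∑-splits-cong l (λ β ρ → sym (ℕΣ.∑-distribˡ xs (G β ρ) (λ x → Y x β ρ)))) (∑-splits-∑ l xs (λ x β ρ → G β ρ * Y x β ρ))

onFirst : {W V : Set} → (ℕ → W → W) → ℕ → W × V → W × V
onFirst c p (w , v) = (c p w , v)

onSecond : {W V : Set} → (ℕ → V → V) → ℕ → W × V → W × V
onSecond c p (w , v) = (w , c p v)

∑-colourings-++ : ∀ {W V : Set} (w₀ : W) (v₀ : V) (cs : List (ℕ → W → W)) (ds : List (ℕ → V → V)) l (H : W × V → ℕ) →
  ∑-colourings (w₀ , v₀) (map onFirst cs ++ map onSecond ds) l H ≡
  ∑-splits l (λ β ρ → ∑-colourings w₀ cs β (λ w → ∑-colourings v₀ ds ρ (λ v → H (w , v))))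
∑-colourings-++ w₀ v₀ cs ds []      H = sym (ℕP.+-identityʳ _)
∑-colourings-++ w₀ v₀ cs ds (p ∷ l) H = begin
  ℕΣ.∑ (map onFirst cs ++ map onSecond ds) (λ c → CC l (H ∘ c p))
    ≡⟨ ℕΣ.∑-++ (map onFirst cs) (map onSecond ds) _ ⟩
  ℕΣ.∑ (map onFirst cs) (λ c → CC l (H ∘ c p)) + ℕΣ.∑ (map onSecond ds) (λ c → CC l (H ∘ c p))
    ≡⟨ cong₂ _+_ (ℕΣ.∑-map onFirst cs _) (ℕΣ.∑-map onSecond ds _) ⟩
  ℕΣ.∑ cs (λ c → CC l (H ∘ onFirst c p)) + ℕΣ.∑ ds (λ d → CC l (H ∘ onSecond d p))
    ≡⟨ cong₂ _+_ (ℕΣ.∑-cong cs (λ c → ∑-colourings-++ w₀ v₀ cs ds l (H ∘ onFirst c p)))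
                 (ℕΣ.∑-cong ds (λ d → ∑-colourings-++ w₀ v₀ cs ds l (H ∘ onSecond d p))) ⟩
  ℕΣ.∑ cs (λ c → ∑-splits l (λ β ρ → ∑-colourings w₀ cs β (λ w → ∑-colourings v₀ ds ρ (λ v → H (c p w , v))))) +
  ℕΣ.∑ ds (λ d → ∑-splits l (λ β ρ → ∑-colourings w₀ cs β (λ w → ∑-colourings v₀ ds ρ (λ v → H (w , d p v)))))
    ≡⟨ cong₂ _+_ (sym (∑-splits-∑ l cs _))
                 (trans (sym (∑-splits-∑ l ds _))
                        (∑-splits-cong l (λ β ρ → sym (Colourings.∑-colourings-∑ w₀ cs β ds _)))) ⟩
  ∑-splits l (λ β ρ → ∑-colourings w₀ cs (p ∷ β) (λ w → ∑-colourings v₀ ds ρ (λ v → H (w , v)))) +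
  ∑-splits l (λ β ρ → ∑-colourings w₀ cs β (λ w → ∑-colourings v₀ ds (p ∷ ρ) (λ v → H (w , v))))
    ≡⟨ ∑-splits-∷ p l _ ⟨
  ∑-splits (p ∷ l) (λ β ρ → ∑-colourings w₀ cs β (λ w → ∑-colourings v₀ ds ρ (λ v → H (w , v)))) ∎
  where
  open ≡-Reasoning
  CC = ∑-colourings (w₀ , v₀) (map onFirst cs ++ map onSecond ds)

-- a weight on the subsets of {1, …, k}: the first half for the subsets avoiding k, the second for those containing k
Weight : ℕ → Set
Weight zero    = ℕ
Weight (suc k) = Weight k × Weight k

0ʷ : ∀ k → Weight k
0ʷ zero    = 0
0ʷ (suc k) = 0ʷ k , 0ʷ k

colours : ∀ k → List (ℕ → Weight k → Weight k)
colours zero    = _+_ ∷ []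
colours (suc k) = map onFirst (colours k) ++ map onSecond (colours k)

total : ∀ k → Weight k → ℕ
total zero    x       = x
total (suc k) (a , b) = total k a + total k b

addʷ : ∀ k → Weight k → Weight k → Weight k
addʷ zero    a       b         = a + b
addʷ (suc k) (a , b) (a′ , b′) = addʷ k a a′ , addʷ k b b′

_≟ʷ_ : ∀ {k} → DecidableEquality (Weight k)
_≟ʷ_ {zero}  = _≟_
_≟ʷ_ {suc k} = ProductP.≡-dec _≟ʷ_ _≟ʷ_

δ : ∀ k → Weight k → Weight k → ℕ
δ k x w = ind (x ≟ʷ w)

∑-col : ∀ k → List ℕ → (Weight k → ℕ) → ℕ
∑-col k = ∑-colourings (0ʷ k) (colours k)

total-0ʷ : ∀ k → total k (0ʷ k) ≡ 0
total-0ʷ zero    = refl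
total-0ʷ (suc k) = cong₂ _+_ (total-0ʷ k) (total-0ʷ k)

All-colours : ∀ k (P : ∀ {j} → (ℕ → Weight j → Weight j) → Set) →
  P {zero} _+_ → (∀ {j} c → P {j} c → P {suc j} (onFirst c)) → (∀ {j} c → P {j} c → P {suc j} (onSecond c)) →
  All (P {k}) (colours k)
All-colours zero    P P+ P₁ P₂ = P+ ∷ []
All-colours (suc k) P P+ P₁ P₂ = AllP.++⁺ (AllP.map⁺ (All.map (P₁ _) (All-colours k P P+ P₁ P₂)))
                                          (AllP.map⁺ (All.map (P₂ _) (All-colours k P P+ P₁ P₂)))

total-colour : ∀ k → All (λ c → ∀ p w → total k (c p w) ≡ p + total k w) (colours k)
total-colour k = All-colours k (λ {j} c → ∀ p w → total j (c p w) ≡ p + total j w) (λ _ _ → refl)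
  (λ {j} c hyp p (a , b) → trans (cong (_+ total j b) (hyp p a)) (ℕP.+-assoc p _ _))
  (λ {j} c hyp p (a , b) → trans (cong (total j a +_) (hyp p b))
                                 (solve 3 (λ a p b → a :+ (p :+ b) := p :+ (a :+ b)) refl (total j a) p (total j b)))
  where open +-*-Solver

addʷ-colourˡ : ∀ k → All (λ c → ∀ p a b → addʷ k (c p a) b ≡ c p (addʷ k a b)) (colours k)
addʷ-colourˡ k = All-colours k (λ {j} c → ∀ p a b → addʷ j (c p a) b ≡ c p (addʷ j a b)) ℕP.+-assoc
  (λ {j} c hyp p (a , a′) (b , b′) → cong (_, addʷ j a′ b′) (hyp p a b))
  (λ {j} c hyp p (a , a′) (b , b′) → cong (addʷ j a b ,_) (hyp p a′ b′))

addʷ-colourʳ : ∀ k → All (λ c → ∀ p a b → addʷ k a (c p b) ≡ c p (addʷ k a b)) (colours k)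
addʷ-colourʳ k = All-colours k (λ {j} c → ∀ p a b → addʷ j a (c p b) ≡ c p (addʷ j a b))
  (λ p a b → solve 3 (λ a p b → a :+ (p :+ b) := p :+ (a :+ b)) refl a p b)
  (λ {j} c hyp p (a , a′) (b , b′) → cong (_, addʷ j a′ b′) (hyp p a b))
  (λ {j} c hyp p (a , a′) (b , b′) → cong (addʷ j a b ,_) (hyp p a′ b′))
  where open +-*-Solver

addʷ-0ʷ : ∀ k → addʷ k (0ʷ k) (0ʷ k) ≡ 0ʷ k
addʷ-0ʷ zero    = refl
addʷ-0ʷ (suc k) = cong₂ _,_ (addʷ-0ʷ k) (addʷ-0ʷ k)

total-addʷ : ∀ k a b → total k (addʷ k a b) ≡ total k a + total k b
total-addʷ zero    a       b         = refl
total-addʷ (suc k) (a , b) (a′ , b′) = trans (cong₂ _+_ (total-addʷ k a a′) (total-addʷ k b b′))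
  (solve 4 (λ a b c d → (a :+ b) :+ (c :+ d) := (a :+ c) :+ (b :+ d)) refl (total k a) (total k a′) (total k b) (total k b′))
  where open +-*-Solver

module ∑-col-Properties (k : ℕ) where
  open Colourings (0ʷ k) (colours k) public
  open Support (total k) (total-0ʷ k) (total-colour k) public

∑-col-zero : ∀ l (H : ℕ → ℕ) → ∑-col 0 l H ≡ H (sum l)
∑-col-zero []      H = refl
∑-col-zero (p ∷ l) H = trans (ℕP.+-identityʳ _) (∑-col-zero l (H ∘ (p +_)))

∑-col-suc : ∀ k l (H : Weight (suc k) → ℕ) → ∑-col (suc k) l H ≡ ∑-splits l (λ β ρ → ∑-col k β (λ a → ∑-col k ρ (λ b → H (a , b))))
∑-col-suc k = ∑-colourings-++ (0ʷ k) (0ʷ k) (colours k) (colours k)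

δ-pair : ∀ k x₁ x₂ a b → δ (suc k) (x₁ , x₂) (a , b) ≡ δ k x₁ a * δ k x₂ b
δ-pair k x₁ x₂ a b = by-cases (x₁ ≟ʷ a) (x₂ ≟ʷ b)
  where
  by-cases : Dec (x₁ ≡ a) → Dec (x₂ ≡ b) → δ (suc k) (x₁ , x₂) (a , b) ≡ δ k x₁ a * δ k x₂ b
  by-cases (yes x₁≡a) (yes x₂≡b) = trans (ind-yes ((x₁ , x₂) ≟ʷ (a , b)) (cong₂ _,_ x₁≡a x₂≡b))
    (sym (cong₂ _*_ (ind-yes (x₁ ≟ʷ a) x₁≡a) (ind-yes (x₂ ≟ʷ b) x₂≡b)))
  by-cases (no x₁≢a) _ = trans (ind-no ((x₁ , x₂) ≟ʷ (a , b)) (x₁≢a ∘ cong proj₁))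
    (sym (cong (_* δ k x₂ b) (ind-no (x₁ ≟ʷ a) x₁≢a)))
  by-cases (yes _) (no x₂≢b) = trans (ind-no ((x₁ , x₂) ≟ʷ (a , b)) (x₂≢b ∘ cong proj₂))
    (sym (trans (cong (δ k x₁ a *_) (ind-no (x₂ ≟ʷ b) x₂≢b)) (ℕP.*-zeroʳ (δ k x₁ a))))

∑/z-δ : ∀ k n x → total k x ≡ n → ∑/z n (λ l → ∑-col k l (δ k x)) ≡ 1ℚ
∑/z-δ zero n x x≡n = trans (ℚΣ.∑-cong-∈ (Partitions n) (λ {l} l∈ →
    cong (λ t → recip (z l) ℚ.* fromℕ t) (trans (∑-col-zero l (δ 0 x)) (ind-yes (x ≟ sum l) (trans x≡n (sym (sum-Partitions {n} l∈)))))))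
  (∑/z-const-1 n)
∑/z-δ (suc k) n (x₁ , x₂) x≡n = begin
  ∑/z n (λ l → ∑-col (suc k) l (δ (suc k) (x₁ , x₂)))
    ≡⟨ ℚΣ.∑-cong (Partitions n) (λ l → cong (λ t → recip (z l) ℚ.* fromℕ t) (δ-splits l)) ⟩
  ∑/z n (λ l → ∑-splits l (λ β ρ → F₁ β * F₂ ρ))
    ≡⟨ ∑-splits-product n F₁ F₂ ⟩
  ℚΣ.∑ (upTo (suc n)) (λ c → ∑/z c F₁ ℚ.* ∑/z (n ∸ c) F₂)
    ≡⟨ ℚΣ.∑-supported-at (λ c → ∑/z c F₁ ℚ.* ∑/z (n ∸ c) F₂) (UniqueP.upTo⁺ (suc n)) (∈-upTo⁺ (s≤s t₁≤n)) vanish ⟩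
  ∑/z t₁ F₁ ℚ.* ∑/z (n ∸ t₁) F₂
    ≡⟨ cong₂ ℚ._*_ (∑/z-δ k t₁ x₁ refl) (∑/z-δ k (n ∸ t₁) x₂ t₂≡) ⟩
  1ℚ ℚ.* 1ℚ
    ≡⟨ ℚP.*-identityˡ 1ℚ ⟩
  1ℚ ∎
  where
  open ≡-Reasoning
  open ∑-col-Properties k
  t₁ = total k x₁
  F₁ F₂ : List ℕ → ℕ
  F₁ β = ∑-col k β (δ k x₁)
  F₂ ρ = ∑-col k ρ (δ k x₂)
  t₁≤n : t₁ ≤ n
  t₁≤n = subst (t₁ ≤_) x≡n (ℕP.m≤m+n t₁ (total k x₂))
  t₂≡ : total k x₂ ≡ n ∸ t₁
  t₂≡ = sym (trans (cong (_∸ t₁) (sym x≡n)) (ℕP.m+n∸m≡n t₁ (total k x₂)))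
  δ-splits : ∀ l → ∑-col (suc k) l (δ (suc k) (x₁ , x₂)) ≡ ∑-splits l (λ β ρ → F₁ β * F₂ ρ)
  δ-splits l = trans (∑-col-suc k l (δ (suc k) (x₁ , x₂))) (∑-splits-cong l (λ β ρ →
    trans (∑-colourings-cong β (λ a → trans (∑-colourings-cong ρ (δ-pair k x₁ x₂ a)) (∑-colourings-distribˡ ρ (δ k x₁ a) (δ k x₂))))
          (∑-colourings-distribʳ β (∑-col k ρ (δ k x₂)) (δ k x₁))))
  vanish : ∀ {c} → c ∈ upTo (suc n) → c ≢ t₁ →
           ∑/z c F₁ ℚ.* ∑/z (n ∸ c) F₂ ≡ 0ℚ
  vanish {c} _ c≢t₁ = trans (cong (ℚ._* ∑/z (n ∸ c) F₂) (trans (ℚΣ.∑-cong-∈ (Partitions c) (λ {β} β∈ →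
      trans (cong (λ t → recip (z β) ℚ.* fromℕ t)
                  (trans (∑-colourings-cong-total β {δ k x₁} {λ _ → 0} (λ w tw → ind-no (x₁ ≟ʷ w) (λ { refl → c≢t₁ (sym (trans tw (sum-Partitions {c} β∈))) })))
                         (∑-colourings-zero β)))
            (ℚP.*-zeroʳ (recip (z β))))) (ℚΣ.∑-zero (Partitions c))))
    (ℚP.*-zeroˡ (∑/z (n ∸ c) F₂))

weightsOfTotal : ∀ k → ℕ → List (Weight k)
weightsOfTotal zero    n = n ∷ []
weightsOfTotal (suc k) n = pairsOfTotal (weightsOfTotal k) n

total-weightsOfTotal : ∀ k {m x} → x ∈ weightsOfTotal k m → total k x ≡ m
weightsOfTotal-unique : ∀ k m → Unique (weightsOfTotal k m)

total-weightsOfTotal zero    (here refl) = refl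
total-weightsOfTotal (suc k) {m} x∈ =
  PairsOfTotal.∈-pairsOfTotal-size (weightsOfTotal k) (total k) (total-weightsOfTotal k) (weightsOfTotal-unique k) m x∈
weightsOfTotal-unique zero    m = [] ∷ []
weightsOfTotal-unique (suc k) m =
  PairsOfTotal.pairsOfTotal-unique (weightsOfTotal k) (total k) (total-weightsOfTotal k) (weightsOfTotal-unique k) m

∈-weightsOfTotal : ∀ k x → x ∈ weightsOfTotal k (total k x)
∈-weightsOfTotal zero    x       = here refl
∈-weightsOfTotal (suc k) (a , b) =
  PairsOfTotal.∈-pairsOfTotal⁺ (weightsOfTotal k) (total k) (total-weightsOfTotal k) (weightsOfTotal-unique k)
    (total k a + total k b) (ℕP.m≤m+n (total k a) (total k b)) (∈-weightsOfTotal k a)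
    (subst (λ m → b ∈ weightsOfTotal k m) (sym (ℕP.m+n∸m≡n (total k a) (total k b))) (∈-weightsOfTotal k b))

∑-col-by-weight : ∀ k l (H : Weight k → ℕ) → ∑-col k l H ≡ ℕΣ.∑ (weightsOfTotal k (sum l)) (λ x → H x * ∑-col k l (δ k x))
∑-col-by-weight k l H = begin
  ∑-col k l H
    ≡⟨ ∑-colourings-cong-total l (λ w w≡ → sym (Counting.∑-indicator _≟ʷ_ H (weightsOfTotal-unique k (sum l))
                                                  (subst (λ m → w ∈ weightsOfTotal k m) w≡ (∈-weightsOfTotal k w)))) ⟩
  ∑-col k l (λ w → ℕΣ.∑ (weightsOfTotal k (sum l)) (λ x → δ k x w * H x))
    ≡⟨ ∑-colourings-∑ l (weightsOfTotal k (sum l)) _ ⟩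
  ℕΣ.∑ (weightsOfTotal k (sum l)) (λ x → ∑-col k l (λ w → δ k x w * H x))
    ≡⟨ ℕΣ.∑-cong (weightsOfTotal k (sum l)) (λ x → trans (∑-colourings-distribʳ l (H x) (δ k x)) (ℕP.*-comm _ (H x))) ⟩
  ℕΣ.∑ (weightsOfTotal k (sum l)) (λ x → H x * ∑-col k l (δ k x)) ∎
  where
  open ≡-Reasoning
  open ∑-col-Properties k

∑/z-∑-col : ∀ k n (H : Weight k → ℕ) → ∑/z n (λ l → ∑-col k l H) ≡ fromℕ (ℕΣ.∑ (weightsOfTotal k n) H)
∑/z-∑-col k n H = begin
  ℚΣ.∑ (Partitions n) (λ l → recip (z l) ℚ.* fromℕ (∑-col k l H))
    ≡⟨ ℚΣ.∑-cong-∈ (Partitions n) (λ {l} l∈ → cong (λ t → recip (z l) ℚ.* fromℕ t) (by-weight l∈)) ⟩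
  ℚΣ.∑ (Partitions n) (λ l → recip (z l) ℚ.* fromℕ (ℕΣ.∑ (weightsOfTotal k n) (λ x → H x * ∑-col k l (δ k x))))
    ≡⟨ ℚΣ.∑-cong (Partitions n) expand ⟩
  ℚΣ.∑ (Partitions n) (λ l → ℚΣ.∑ (weightsOfTotal k n) (λ x → term l x))
    ≡⟨ ℚΣ.∑-comm (Partitions n) (weightsOfTotal k n) term ⟩
  ℚΣ.∑ (weightsOfTotal k n) (λ x → ℚΣ.∑ (Partitions n) (λ l → term l x))
    ≡⟨ ℚΣ.∑-cong-∈ (weightsOfTotal k n) collapse ⟩
  ℚΣ.∑ (weightsOfTotal k n) (λ x → fromℕ (H x))
    ≡⟨ ∑-fromℕ (weightsOfTotal k n) H ⟩
  fromℕ (ℕΣ.∑ (weightsOfTotal k n) H) ∎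
  where
  open ≡-Reasoning
  open ℚSolver.+-*-Solver
  term : List ℕ → Weight k → ℚ
  term l x = fromℕ (H x) ℚ.* (recip (z l) ℚ.* fromℕ (∑-col k l (δ k x)))
  by-weight : ∀ {l} → l ∈ Partitions n → ∑-col k l H ≡ ℕΣ.∑ (weightsOfTotal k n) (λ x → H x * ∑-col k l (δ k x))
  by-weight {l} l∈ = trans (∑-col-by-weight k l H)
    (cong (λ m → ℕΣ.∑ (weightsOfTotal k m) (λ x → H x * ∑-col k l (δ k x))) (sum-Partitions {n} l∈))
  expand : ∀ l → recip (z l) ℚ.* fromℕ (ℕΣ.∑ (weightsOfTotal k n) (λ x → H x * ∑-col k l (δ k x))) ≡
                 ℚΣ.∑ (weightsOfTotal k n) (λ x → term l x)
  expand l = begin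
    recip (z l) ℚ.* fromℕ (ℕΣ.∑ (weightsOfTotal k n) (λ x → H x * ∑-col k l (δ k x)))
      ≡⟨ cong (recip (z l) ℚ.*_) (∑-fromℕ (weightsOfTotal k n) (λ x → H x * ∑-col k l (δ k x))) ⟨
    recip (z l) ℚ.* ℚΣ.∑ (weightsOfTotal k n) (λ x → fromℕ (H x * ∑-col k l (δ k x)))
      ≡⟨ ℚΣ.∑-distribˡ (weightsOfTotal k n) (recip (z l)) (λ x → fromℕ (H x * ∑-col k l (δ k x))) ⟨
    ℚΣ.∑ (weightsOfTotal k n) (λ x → recip (z l) ℚ.* fromℕ (H x * ∑-col k l (δ k x)))
      ≡⟨ ℚΣ.∑-cong (weightsOfTotal k n) (λ x → trans (cong (recip (z l) ℚ.*_) (fromℕ-* (H x) (∑-col k l (δ k x))))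
           (solve 3 (λ r h c → r :* (h :* c) := h :* (r :* c)) refl (recip (z l)) (fromℕ (H x)) (fromℕ (∑-col k l (δ k x))))) ⟩
    ℚΣ.∑ (weightsOfTotal k n) (λ x → term l x) ∎
  collapse : ∀ {x} → x ∈ weightsOfTotal k n → ℚΣ.∑ (Partitions n) (λ l → term l x) ≡ fromℕ (H x)
  collapse {x} x∈ = begin
    ℚΣ.∑ (Partitions n) (λ l → term l x)
      ≡⟨ ℚΣ.∑-distribˡ (Partitions n) (fromℕ (H x)) (λ l → recip (z l) ℚ.* fromℕ (∑-col k l (δ k x))) ⟩
    fromℕ (H x) ℚ.* ∑/z n (λ l → ∑-col k l (δ k x))
      ≡⟨ cong (fromℕ (H x) ℚ.*_) (∑/z-δ k n x (total-weightsOfTotal k x∈)) ⟩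
    fromℕ (H x) ℚ.* 1ℚ
      ≡⟨ ℚP.*-identityʳ (fromℕ (H x)) ⟩
    fromℕ (H x) ∎

∑-splits-∑-col-addʷ : ∀ k l (G : List ℕ → List ℕ → ℕ) (H : Weight k → ℕ) →
  ∑-splits l (λ β ρ → G β ρ * ∑-col k β (λ a → ∑-col k ρ (λ b → H (addʷ k a b)))) ≡ ∑-splits l (λ β ρ → G β ρ * ∑-col k l H)
∑-splits-∑-col-addʷ k []      G H = cong (λ w → G [] [] * H w + 0) (addʷ-0ʷ k)
∑-splits-∑-col-addʷ k (p ∷ l) G H = begin
  ∑-splits (p ∷ l) (λ β ρ → G β ρ * X β ρ)
    ≡⟨ ∑-splits-∷ p l (λ β ρ → G β ρ * X β ρ) ⟩
  ∑-splits l (λ β ρ → Gˡ β ρ * X (p ∷ β) ρ) + ∑-splits l (λ β ρ → Gʳ β ρ * X β (p ∷ ρ))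
    ≡⟨ cong₂ _+_ (∑-splits-cong l (λ β ρ → cong (Gˡ β ρ *_) (colour-first β ρ)))
                 (∑-splits-cong l (λ β ρ → cong (Gʳ β ρ *_) (colour-second β ρ))) ⟩
  ∑-splits l (λ β ρ → Gˡ β ρ * ℕΣ.∑ (colours k) (λ c → Xᶜ c β ρ)) + ∑-splits l (λ β ρ → Gʳ β ρ * ℕΣ.∑ (colours k) (λ c → Xᶜ c β ρ))
    ≡⟨ cong₂ _+_ (∑-splits-*-∑ l (colours k) Gˡ Xᶜ) (∑-splits-*-∑ l (colours k) Gʳ Xᶜ) ⟩
  ℕΣ.∑ (colours k) (λ c → ∑-splits l (λ β ρ → Gˡ β ρ * Xᶜ c β ρ)) + ℕΣ.∑ (colours k) (λ c → ∑-splits l (λ β ρ → Gʳ β ρ * Xᶜ c β ρ))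
    ≡⟨ cong₂ _+_ (ℕΣ.∑-cong (colours k) (λ c → ∑-splits-∑-col-addʷ k l Gˡ (H ∘ c p)))
                 (ℕΣ.∑-cong (colours k) (λ c → ∑-splits-∑-col-addʷ k l Gʳ (H ∘ c p))) ⟩
  ℕΣ.∑ (colours k) (λ c → ∑-splits l (λ β ρ → Gˡ β ρ * ∑-col k l (H ∘ c p))) +
  ℕΣ.∑ (colours k) (λ c → ∑-splits l (λ β ρ → Gʳ β ρ * ∑-col k l (H ∘ c p)))
    ≡⟨ cong₂ _+_ (sym (∑-splits-*-∑ l (colours k) Gˡ (λ c β ρ → ∑-col k l (H ∘ c p))))
                 (sym (∑-splits-*-∑ l (colours k) Gʳ (λ c β ρ → ∑-col k l (H ∘ c p)))) ⟩
  ∑-splits l (λ β ρ → Gˡ β ρ * ∑-col k (p ∷ l) H) + ∑-splits l (λ β ρ → Gʳ β ρ * ∑-col k (p ∷ l) H)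
    ≡⟨ ∑-splits-∷ p l (λ β ρ → G β ρ * ∑-col k (p ∷ l) H) ⟨
  ∑-splits (p ∷ l) (λ β ρ → G β ρ * ∑-col k (p ∷ l) H) ∎
  where
  open ≡-Reasoning
  open ∑-col-Properties k
  X : List ℕ → List ℕ → ℕ
  X β ρ = ∑-col k β (λ a → ∑-col k ρ (λ b → H (addʷ k a b)))
  Gˡ Gʳ : List ℕ → List ℕ → ℕ
  Gˡ β ρ = G (p ∷ β) ρ
  Gʳ β ρ = G β (p ∷ ρ)
  Xᶜ : (ℕ → Weight k → Weight k) → List ℕ → List ℕ → ℕ
  Xᶜ c β ρ = ∑-col k β (λ a → ∑-col k ρ (λ b → H (c p (addʷ k a b))))
  colour-first : ∀ β ρ → X (p ∷ β) ρ ≡ ℕΣ.∑ (colours k) (λ c → Xᶜ c β ρ)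
  colour-first β ρ = ℕΣ.∑-cong-∈ (colours k) (λ c∈ →
    ∑-colourings-cong β (λ a → ∑-colourings-cong ρ (λ b → cong H (All.lookup (addʷ-colourˡ k) c∈ p a b))))
  colour-second : ∀ β ρ → X β (p ∷ ρ) ≡ ℕΣ.∑ (colours k) (λ c → Xᶜ c β ρ)
  colour-second β ρ = trans
    (∑-colourings-cong β (λ a → ℕΣ.∑-cong-∈ (colours k) (λ c∈ →
      ∑-colourings-cong ρ (λ b → cong H (All.lookup (addʷ-colourʳ k) c∈ p a b)))))
    (∑-colourings-∑ β (colours k) (λ c a → ∑-col k ρ (λ b → H (c p (addʷ k a b)))))

secondSumCount : List ℕ → ℕ → ℕ
secondSumCount l v = ∑-splits l (λ β ρ → ind (sum ρ ≟ v))

module Margins (ν : ℕ → ℕ) where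

  -- for each j ≤ k, the subsets containing j carry total weight ν j
  hasMargins : ∀ k → Weight k → Bool
  hasMargins zero    _       = true
  hasMargins (suc k) (a , b) = hasMargins k (addʷ k a b) ∧ does (total k b ≟ ν (suc k))

  marginCount : ℕ → List ℕ → ℕ
  marginCount zero    l = 1
  marginCount (suc k) l = marginCount k l * secondSumCount l (ν (suc k))

  ∑-col-hasMargins : ∀ k l → ∑-col k l (λ w → indB (hasMargins k w)) ≡ marginCount k l
  ∑-col-hasMargins zero    l = ∑-col-zero l (λ _ → 1)
  ∑-col-hasMargins (suc k) l = begin
    ∑-col (suc k) l (λ w → indB (hasMargins (suc k) w))
      ≡⟨ ∑-col-suc k l (λ w → indB (hasMargins (suc k) w)) ⟩
    ∑-splits l (λ β ρ → ∑-col k β (λ a → ∑-col k ρ (λ b → indB (hasMargins k (addʷ k a b) ∧ does (total k b ≟ v)))))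
      ≡⟨ ∑-splits-cong l last-margin ⟩
    ∑-splits l (λ β ρ → ind (sum ρ ≟ v) * ∑-col k β (λ a → ∑-col k ρ (λ b → M (addʷ k a b))))
      ≡⟨ ∑-splits-∑-col-addʷ k l (λ β ρ → ind (sum ρ ≟ v)) M ⟩
    ∑-splits l (λ β ρ → ind (sum ρ ≟ v) * ∑-col k l M)
      ≡⟨ ∑-splits-distribʳ l (λ β ρ → ind (sum ρ ≟ v)) (∑-col k l M) ⟩
    secondSumCount l v * ∑-col k l M
      ≡⟨ cong (secondSumCount l v *_) (∑-col-hasMargins k l) ⟩
    secondSumCount l v * marginCount k l
      ≡⟨ ℕP.*-comm (secondSumCount l v) (marginCount k l) ⟩
    marginCount k l * secondSumCount l v ∎
    where
    open ≡-Reasoning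
    open ∑-col-Properties k
    v = ν (suc k)
    M : Weight k → ℕ
    M w = indB (hasMargins k w)
    last-margin : ∀ β ρ → ∑-col k β (λ a → ∑-col k ρ (λ b → indB (hasMargins k (addʷ k a b) ∧ does (total k b ≟ v)))) ≡
                          ind (sum ρ ≟ v) * ∑-col k β (λ a → ∑-col k ρ (λ b → M (addʷ k a b)))
    last-margin β ρ = begin
      ∑-col k β (λ a → ∑-col k ρ (λ b → indB (hasMargins k (addʷ k a b) ∧ does (total k b ≟ v))))
        ≡⟨ ∑-colourings-cong β (λ a → ∑-colourings-cong-total ρ (λ b total≡ →
             trans (indB-∧ (hasMargins k (addʷ k a b)) _) (cong (λ t → M (addʷ k a b) * ind (t ≟ v)) total≡))) ⟩
      ∑-col k β (λ a → ∑-col k ρ (λ b → M (addʷ k a b) * ind (sum ρ ≟ v)))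
        ≡⟨ ∑-colourings-cong β (λ a → ∑-colourings-distribʳ ρ (ind (sum ρ ≟ v)) (λ b → M (addʷ k a b))) ⟩
      ∑-col k β (λ a → ∑-col k ρ (λ b → M (addʷ k a b)) * ind (sum ρ ≟ v))
        ≡⟨ ∑-colourings-distribʳ β (ind (sum ρ ≟ v)) (λ a → ∑-col k ρ (λ b → M (addʷ k a b))) ⟩
      ∑-col k β (λ a → ∑-col k ρ (λ b → M (addʷ k a b))) * ind (sum ρ ≟ v)
        ≡⟨ ℕP.*-comm _ (ind (sum ρ ≟ v)) ⟩
      ind (sum ρ ≟ v) * ∑-col k β (λ a → ∑-col k ρ (λ b → M (addʷ k a b))) ∎

-- The coefficient of s_(n) in the Kronecker product

secondSumCount-by-parts : ∀ μ₁ μ₂ {l} → l ∈ Partitions (μ₁ + μ₂) →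
  secondSumCount l μ₂ ≡ ℕΣ.∑ (Partitions μ₁) (λ α → ℕΣ.∑ (Partitions μ₂) (λ β → countPair (α , β) (splits l)))
secondSumCount-by-parts μ₁ μ₂ {l} l∈ = begin
  secondSumCount l μ₂
    ≡⟨ Counting.∑-group _≟ᴾ_ (splits l) (λ s → ind (sum (proj₂ s) ≟ μ₂)) (pairsOfTotal-unique n)
         (All.tabulate (splits⊆pairsOfPartitions {n} l∈)) ⟩
  ℕΣ.∑ (pairsOfTotal Partitions n) (λ e → countPair e (splits l) * ind (sum (proj₂ e) ≟ μ₂))
    ≡⟨ ∑-pairsOfTotal ℕP.+-*-commutativeSemiring n (λ e → countPair e (splits l) * ind (sum (proj₂ e) ≟ μ₂)) ⟩
  ℕΣ.∑ (upTo (suc n)) (λ c → ℕΣ.∑ (Partitions c) (λ α → ℕΣ.∑ (Partitions (n ∸ c)) (λ β → term α β)))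
    ≡⟨ ℕΣ.∑-supported-at _ (UniqueP.upTo⁺ (suc n)) (∈-upTo⁺ (s≤s (ℕP.m≤m+n μ₁ μ₂))) other-sizes ⟩
  ℕΣ.∑ (Partitions μ₁) (λ α → ℕΣ.∑ (Partitions (n ∸ μ₁)) (λ β → term α β))
    ≡⟨ ℕΣ.∑-cong (Partitions μ₁) (λ α → trans (cong (λ m → ℕΣ.∑ (Partitions m) (λ β → term α β)) (ℕP.m+n∸m≡n μ₁ μ₂))
         (ℕΣ.∑-cong-∈ (Partitions μ₂) (λ {β} β∈ →
           trans (cong (countPair (α , β) (splits l) *_) (ind-yes (sum β ≟ μ₂) (sum-Partitions {μ₂} β∈))) (ℕP.*-identityʳ _)))) ⟩
  ℕΣ.∑ (Partitions μ₁) (λ α → ℕΣ.∑ (Partitions μ₂) (λ β → countPair (α , β) (splits l))) ∎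
  where
  open ≡-Reasoning
  n = μ₁ + μ₂
  term : List ℕ → List ℕ → ℕ
  term α β = countPair (α , β) (splits l) * ind (sum β ≟ μ₂)
  other-sizes : ∀ {c} → c ∈ upTo (suc n) → c ≢ μ₁ → ℕΣ.∑ (Partitions c) (λ α → ℕΣ.∑ (Partitions (n ∸ c)) (λ β → term α β)) ≡ 0
  other-sizes {c} c∈ c≢μ₁ = trans (ℕΣ.∑-cong (Partitions c) (λ α → trans (ℕΣ.∑-cong-∈ (Partitions (n ∸ c)) (λ {β} β∈ →
      trans (cong (countPair (α , β) (splits l) *_) (ind-no (sum β ≟ μ₂) (λ Σβ → c≢μ₁ (size-c (trans (sym (sum-Partitions {n ∸ c} β∈)) Σβ)))))
            (ℕP.*-zeroʳ (countPair (α , β) (splits l))))) (ℕΣ.∑-zero (Partitions (n ∸ c))))) (ℕΣ.∑-zero (Partitions c))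
    where
    size-c : n ∸ c ≡ μ₂ → c ≡ μ₁
    size-c eq = ℕP.+-cancelʳ-≡ μ₂ c μ₁ (sym (trans (sym (ℕP.m+[n∸m]≡n (ℕP.≤-pred (∈-upTo⁻ c∈)))) (cong (c +_) eq)))

private
  Σℚ-++ : ∀ xs ys → Σℚ (xs ++ ys) ≡ Σℚ xs ℚ.+ Σℚ ys
  Σℚ-++ []       ys = sym (ℚP.+-identityˡ (Σℚ ys))
  Σℚ-++ (x ∷ xs) ys = trans (cong (x ℚ.+_) (Σℚ-++ xs ys)) (sym (ℚP.+-assoc x (Σℚ xs) (Σℚ ys)))

  Σℚ-concatMap : ∀ (f : A → List ℚ) xs → Σℚ (concatMap f xs) ≡ ℚΣ.∑ xs (λ x → Σℚ (f x))
  Σℚ-concatMap f []       = refl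
  Σℚ-concatMap f (x ∷ xs) = trans (Σℚ-++ (f x) (concatMap f xs)) (cong (Σℚ (f x) ℚ.+_) (Σℚ-concatMap f xs))

  Σℚ-if : ∀ b r → Σℚ (if b then r ∷ [] else []) ≡ fromℕ (indB b) ℚ.* r
  Σℚ-if true  r = trans (ℚP.+-identityʳ r) (sym (ℚP.*-identityˡ r))
  Σℚ-if false r = sym (ℚP.*-zeroˡ r)

  h₂-term : List ℕ → List ℕ → List ℕ → ℚ
  h₂-term l α β = fromℕ (ind (LP.≡-dec _≟_ (∪ₚ α β) l)) ℚ.* (recip (z α) ℚ.* recip (z β))

  -- z_l / (z_α z_β) is the number of ways of splitting the parts of l into α and β
  z-h₂-term : ∀ {n} l α β → l ∈ Partitions n → IsPartition (sum α) α → IsPartition (sum β) β →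
              fromℕ (z l) ℚ.* h₂-term l α β ≡ fromℕ (countPair (α , β) (splits l))
  z-h₂-term {n} l α β l∈ (dα , pα , _) (dβ , pβ , _) = by-cases (LP.≡-dec _≟_ (∪ₚ α β) l)
    where
    by-cases : Dec (∪ₚ α β ≡ l) → fromℕ (z l) ℚ.* h₂-term l α β ≡ fromℕ (countPair (α , β) (splits l))
    by-cases (yes refl) = begin
      fromℕ (z l) ℚ.* (fromℕ (ind (LP.≡-dec _≟_ l l)) ℚ.* (recip (z α) ℚ.* recip (z β)))
        ≡⟨ cong (λ t → fromℕ (z l) ℚ.* (fromℕ t ℚ.* (recip (z α) ℚ.* recip (z β)))) (ind-yes (LP.≡-dec _≟_ l l) refl) ⟩
      fromℕ (z l) ℚ.* (1ℚ ℚ.* (recip (z α) ℚ.* recip (z β)))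
        ≡⟨ cong (fromℕ (z l) ℚ.*_) (ℚP.*-identityˡ (recip (z α) ℚ.* recip (z β))) ⟩
      fromℕ (z l) ℚ.* (recip (z α) ℚ.* recip (z β))
        ≡⟨ fromℕ-as-quotient (countPair (α , β) (splits l)) (z α) (z β) (z l) (splitCount-z α β dα dβ pα pβ)
             (z-positive α pα) (z-positive β pβ) ⟨
      fromℕ (countPair (α , β) (splits l)) ∎
      where open ≡-Reasoning
    by-cases (no ∪≢l) = begin
      fromℕ (z l) ℚ.* (fromℕ (ind (LP.≡-dec _≟_ (∪ₚ α β) l)) ℚ.* (recip (z α) ℚ.* recip (z β)))
        ≡⟨ cong (λ t → fromℕ (z l) ℚ.* (fromℕ t ℚ.* (recip (z α) ℚ.* recip (z β)))) (ind-no (LP.≡-dec _≟_ (∪ₚ α β) l) ∪≢l) ⟩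
      fromℕ (z l) ℚ.* (0ℚ ℚ.* (recip (z α) ℚ.* recip (z β)))
        ≡⟨ trans (cong (fromℕ (z l) ℚ.*_) (ℚP.*-zeroˡ (recip (z α) ℚ.* recip (z β)))) (ℚP.*-zeroʳ (fromℕ (z l))) ⟩
      0ℚ
        ≡⟨ cong fromℕ (count-splits-≢ l (α , β) (proj₁ (Partitions-sound {n} l∈)) ∪≢l) ⟨
      fromℕ (countPair (α , β) (splits l)) ∎
      where open ≡-Reasoning

h₂-secondSumCount : ∀ μ₁ μ₂ l → l ∈ Partitions (μ₁ + μ₂) → h₂ μ₁ μ₂ l ≡ fromℕ (secondSumCount l μ₂)
h₂-secondSumCount μ₁ μ₂ l l∈ = begin
  fromℕ (z l) ℚ.* Σℚ (concatMap (λ α → concatMap (λ β → entry α β) (Partitions μ₂)) (Partitions μ₁))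
    ≡⟨ cong (fromℕ (z l) ℚ.*_) flatten ⟩
  fromℕ (z l) ℚ.* ℚΣ.∑ (Partitions μ₁) (λ α → ℚΣ.∑ (Partitions μ₂) (λ β → h₂-term l α β))
    ≡⟨ ℚΣ.∑-distribˡ (Partitions μ₁) (fromℕ (z l)) (λ α → ℚΣ.∑ (Partitions μ₂) (λ β → h₂-term l α β)) ⟨
  ℚΣ.∑ (Partitions μ₁) (λ α → fromℕ (z l) ℚ.* ℚΣ.∑ (Partitions μ₂) (λ β → h₂-term l α β))
    ≡⟨ ℚΣ.∑-cong-∈ (Partitions μ₁) (λ {α} α∈ → trans
         (sym (ℚΣ.∑-distribˡ (Partitions μ₂) (fromℕ (z l)) (λ β → h₂-term l α β)))
         (ℚΣ.∑-cong-∈ (Partitions μ₂) (λ {β} β∈ → z-h₂-term {μ₁ + μ₂} l α β l∈ (isP {μ₁} α∈) (isP {μ₂} β∈)))) ⟩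
  ℚΣ.∑ (Partitions μ₁) (λ α → ℚΣ.∑ (Partitions μ₂) (λ β → fromℕ (countPair (α , β) (splits l))))
    ≡⟨ ℚΣ.∑-cong (Partitions μ₁) (λ α → ∑-fromℕ (Partitions μ₂) (λ β → countPair (α , β) (splits l))) ⟩
  ℚΣ.∑ (Partitions μ₁) (λ α → fromℕ (ℕΣ.∑ (Partitions μ₂) (λ β → countPair (α , β) (splits l))))
    ≡⟨ ∑-fromℕ (Partitions μ₁) (λ α → ℕΣ.∑ (Partitions μ₂) (λ β → countPair (α , β) (splits l))) ⟩
  fromℕ (ℕΣ.∑ (Partitions μ₁) (λ α → ℕΣ.∑ (Partitions μ₂) (λ β → countPair (α , β) (splits l))))
    ≡⟨ cong fromℕ (secondSumCount-by-parts μ₁ μ₂ l∈) ⟨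
  fromℕ (secondSumCount l μ₂) ∎
  where
  open ≡-Reasoning
  entry : List ℕ → List ℕ → List ℚ
  entry α β = if does (LP.≡-dec _≟_ (∪ₚ α β) l) then (recip (z α) ℚ.* recip (z β)) ∷ [] else []
  isP : ∀ {m x} → x ∈ Partitions m → IsPartition (sum x) x
  isP {m} x∈ = let d , p , _ = Partitions-sound {m} x∈ in d , p , refl
  flatten : Σℚ (concatMap (λ α → concatMap (λ β → entry α β) (Partitions μ₂)) (Partitions μ₁)) ≡
            ℚΣ.∑ (Partitions μ₁) (λ α → ℚΣ.∑ (Partitions μ₂) (λ β → h₂-term l α β))
  flatten = trans (Σℚ-concatMap (λ α → concatMap (λ β → entry α β) (Partitions μ₂)) (Partitions μ₁))
    (ℚΣ.∑-cong (Partitions μ₁) (λ α → trans (Σℚ-concatMap (λ β → entry α β) (Partitions μ₂))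
      (ℚΣ.∑-cong (Partitions μ₂) (λ β → Σℚ-if (does (LP.≡-dec _≟_ (∪ₚ α β) l)) (recip (z α) ℚ.* recip (z β))))))

targetMult-≤a : ∀ d a k {i} → 1 ≤ i → i ≤ a → targetMult d a k i ≡ d
targetMult-≤a d a k {i} 1≤i i≤a rewrite dec-true (1 ≤? i) 1≤i | dec-true (i ≤? a) i≤a = refl

targetMult->a : ∀ d a k {i} → a < i → i ≤ k → targetMult d a k i ≡ d ∸ 1
targetMult->a d a k {i} a<i i≤k
  rewrite dec-true (1 ≤? i) (ℕP.≤-trans (s≤s z≤n) a<i) | dec-false (i ≤? a) (ℕP.<⇒≱ a<i) | dec-true (i ≤? k) i≤k = refl

targetMult->k : ∀ d a k {i} → a ≤ k → k < i → targetMult d a k i ≡ 0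
targetMult->k d a k {i} a≤k k<i
  rewrite dec-true (1 ≤? i) (ℕP.≤-trans (s≤s z≤n) k<i) | dec-false (i ≤? a) (ℕP.<⇒≱ (ℕP.≤-<-trans a≤k k<i))
        | dec-false (i ≤? k) (ℕP.<⇒≱ k<i) = refl

kronAll-++ : ∀ (fs gs : List SymFn) l → kronAll (fs ++ gs) l ≡ kronAll fs l ℚ.* kronAll gs l
kronAll-++ []       gs l = sym (ℚP.*-identityˡ (kronAll gs l))
kronAll-++ (f ∷ fs) gs l = trans (cong (f l ℚ.*_) (kronAll-++ fs gs l)) (sym (ℚP.*-assoc (f l) (kronAll fs l) (kronAll gs l)))

kronAll-replicate : ∀ (f : SymFn) m l x → f l ≡ fromℕ x → kronAll (replicate m f) l ≡ fromℕ (x ^ m)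
kronAll-replicate f zero    l x _    = refl
kronAll-replicate f (suc m) l x fl≡x = trans (cong₂ ℚ._*_ fl≡x (kronAll-replicate f m l x fl≡x)) (sym (fromℕ-* x (x ^ m)))

module TargetMargins (d a k : ℕ) (a≤k : a ≤ k) where

  open Margins (targetMult d a k) public

  private
    marginCount-≤a : ∀ j l → j ≤ a → marginCount j l ≡ secondSumCount l d ^ j
    marginCount-≤a zero    l _   = refl
    marginCount-≤a (suc j) l j<a = trans
      (cong₂ _*_ (marginCount-≤a j l (ℕP.<⇒≤ j<a)) (cong (secondSumCount l) (targetMult-≤a d a k (s≤s z≤n) j<a)))
      (ℕP.*-comm (secondSumCount l d ^ j) (secondSumCount l d))

    marginCount->a : ∀ i l → a + i ≤ k → marginCount (a + i) l ≡ secondSumCount l d ^ a * secondSumCount l (d ∸ 1) ^ i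
    marginCount->a zero    l _ = begin
      marginCount (a + 0) l             ≡⟨ cong (λ j → marginCount j l) (ℕP.+-identityʳ a) ⟩
      marginCount a l                   ≡⟨ marginCount-≤a a l ℕP.≤-refl ⟩
      secondSumCount l d ^ a            ≡⟨ ℕP.*-identityʳ _ ⟨
      secondSumCount l d ^ a * 1        ∎
      where open ≡-Reasoning
    marginCount->a (suc i) l a+i<k = begin
      marginCount (a + suc i) l
        ≡⟨ cong (λ j → marginCount j l) (ℕP.+-suc a i) ⟩
      marginCount (a + i) l * secondSumCount l (targetMult d a k (suc (a + i)))
        ≡⟨ cong₂ _*_ (marginCount->a i l (ℕP.<⇒≤ (subst (_≤ k) (ℕP.+-suc a i) a+i<k)))
                     (cong (secondSumCount l) (targetMult->a d a k (s≤s (ℕP.m≤m+n a i)) (subst (_≤ k) (ℕP.+-suc a i) a+i<k))) ⟩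
      Sᵈ ^ a * S₋ ^ i * S₋
        ≡⟨ solve 3 (λ x y z → x :* y :* z := x :* (z :* y)) refl (Sᵈ ^ a) (S₋ ^ i) S₋ ⟩
      Sᵈ ^ a * S₋ ^ suc i ∎
      where
      open ≡-Reasoning
      open +-*-Solver
      Sᵈ = secondSumCount l d
      S₋ = secondSumCount l (d ∸ 1)

  marginCount-k : ∀ l → marginCount k l ≡ secondSumCount l d ^ a * secondSumCount l (d ∸ 1) ^ (k ∸ a)
  marginCount-k l = trans (cong (λ j → marginCount j l) (sym (ℕP.m+[n∸m]≡n a≤k)))
                          (marginCount->a (k ∸ a) l (ℕP.≤-reflexive (ℕP.m+[n∸m]≡n a≤k)))

  kronAll-factors : 1 ≤ d → ∀ l → l ∈ Partitions (2 * d) → kronAll (factors d a k) l ≡ fromℕ (marginCount k l)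
  kronAll-factors 1≤d l l∈ = begin
    kronAll (factors d a k) l
      ≡⟨ kronAll-++ (replicate a (h₂ d d)) (replicate (k ∸ a) (h₂ (suc d) (d ∸ 1))) l ⟩
    kronAll (replicate a (h₂ d d)) l ℚ.* kronAll (replicate (k ∸ a) (h₂ (suc d) (d ∸ 1))) l
      ≡⟨ cong₂ ℚ._*_ (kronAll-replicate (h₂ d d) a l (secondSumCount l d) (h₂-secondSumCount d d l (subst (λ m → l ∈ Partitions m) 2d≡d+d l∈)))
                     (kronAll-replicate (h₂ (suc d) (d ∸ 1)) (k ∸ a) l (secondSumCount l (d ∸ 1))
                       (h₂-secondSumCount (suc d) (d ∸ 1) l (subst (λ m → l ∈ Partitions m) 2d≡sd+d-1 l∈))) ⟩
    fromℕ (secondSumCount l d ^ a) ℚ.* fromℕ (secondSumCount l (d ∸ 1) ^ (k ∸ a))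
      ≡⟨ fromℕ-* (secondSumCount l d ^ a) (secondSumCount l (d ∸ 1) ^ (k ∸ a)) ⟨
    fromℕ (secondSumCount l d ^ a * secondSumCount l (d ∸ 1) ^ (k ∸ a))
      ≡⟨ cong fromℕ (marginCount-k l) ⟨
    fromℕ (marginCount k l) ∎
    where
    open ≡-Reasoning
    2d≡d+d : 2 * d ≡ d + d
    2d≡d+d = cong (d +_) (ℕP.+-identityʳ d)
    2d≡sd+d-1 : 2 * d ≡ suc d + (d ∸ 1)
    2d≡sd+d-1 = trans 2d≡d+d (trans (cong (d +_) (sym (ℕP.m+[n∸m]≡n 1≤d))) (ℕP.+-suc d (d ∸ 1)))

  private
    Σℚ-map : ∀ (xs : List A) (f : A → ℚ) → Σℚ (map f xs) ≡ ℚΣ.∑ xs f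
    Σℚ-map []       f = refl
    Σℚ-map (x ∷ xs) f = cong (f x ℚ.+_) (Σℚ-map xs f)

  coeffSRow-kronAll-factors : 1 ≤ d →
    coeffSRow (2 * d) (kronAll (factors d a k)) ≡ fromℕ (ℕΣ.∑ (weightsOfTotal k (2 * d)) (λ w → indB (hasMargins k w)))
  coeffSRow-kronAll-factors 1≤d = begin
    Σℚ (map (λ l → kronAll (factors d a k) l ℚ.* sRow l ℚ.* recip (z l)) (Partitions (2 * d)))
      ≡⟨ Σℚ-map (Partitions (2 * d)) (λ l → kronAll (factors d a k) l ℚ.* sRow l ℚ.* recip (z l)) ⟩
    ℚΣ.∑ (Partitions (2 * d)) (λ l → kronAll (factors d a k) l ℚ.* sRow l ℚ.* recip (z l))
      ≡⟨ ℚΣ.∑-cong-∈ (Partitions (2 * d)) (λ {l} l∈ → per-partition l l∈) ⟩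
    ∑/z (2 * d) (λ l → ∑-col k l (λ w → indB (hasMargins k w)))
      ≡⟨ ∑/z-∑-col k (2 * d) (λ w → indB (hasMargins k w)) ⟩
    fromℕ (ℕΣ.∑ (weightsOfTotal k (2 * d)) (λ w → indB (hasMargins k w))) ∎
    where
    open ≡-Reasoning
    per-partition : ∀ l → l ∈ Partitions (2 * d) →
      kronAll (factors d a k) l ℚ.* sRow l ℚ.* recip (z l) ≡ recip (z l) ℚ.* fromℕ (∑-col k l (λ w → indB (hasMargins k w)))
    per-partition l l∈ = begin
      kronAll (factors d a k) l ℚ.* 1ℚ ℚ.* recip (z l)
        ≡⟨ cong (ℚ._* recip (z l)) (ℚP.*-identityʳ (kronAll (factors d a k) l)) ⟩
      kronAll (factors d a k) l ℚ.* recip (z l)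
        ≡⟨ ℚP.*-comm (kronAll (factors d a k) l) (recip (z l)) ⟩
      recip (z l) ℚ.* kronAll (factors d a k) l
        ≡⟨ cong (recip (z l) ℚ.*_) (kronAll-factors 1≤d l l∈) ⟩
      recip (z l) ℚ.* fromℕ (marginCount k l)
        ≡⟨ cong (λ t → recip (z l) ℚ.* fromℕ t) (∑-col-hasMargins k l) ⟨
      recip (z l) ℚ.* fromℕ (∑-col k l (λ w → indB (hasMargins k w))) ∎

-- One-row set valued tableaux

AllPairs-replicate : ∀ {R : A → A → Set} n {x} → R x x → AllPairs R (replicate n x)
AllPairs-replicate zero    _   = []
AllPairs-replicate (suc n) Rxx = AllP.replicate⁺ n Rxx ∷ AllPairs-replicate n Rxx

LabelIn : ℕ → List ℕ → Set
LabelIn k A = All (λ i → 1 ≤ i × i ≤ k) A × Linked (λ u v → v < u) A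

-- the multiset of subsets described by a weight, as a weakly increasing row of labels
labels : ∀ k → Weight k → List (List ℕ)
labels zero    x       = replicate x []
labels (suc k) (a , b) = labels k a ++ map (suc k ∷_) (labels k b)

tableau : ∀ k → Weight k → List (List ℕ)
tableau zero    x       = []
tableau (suc k) (a , b) = tableau k a ++ map (suc k ∷_) (labels k b)

emptyCount : ∀ k → Weight k → ℕ
emptyCount zero    x       = x
emptyCount (suc k) (a , b) = emptyCount k a

labels-tableau : ∀ k x → labels k x ≡ replicate (emptyCount k x) [] ++ tableau k x
labels-tableau zero    x       = sym (LP.++-identityʳ _)
labels-tableau (suc k) (a , b) = trans (cong (_++ map (suc k ∷_) (labels k b)) (labels-tableau k a))
                                       (LP.++-assoc (replicate (emptyCount k a) []) (tableau k a) _)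

length-labels : ∀ k x → length (labels k x) ≡ total k x
length-labels zero    x       = LP.length-replicate x
length-labels (suc k) (a , b) = trans (LP.length-++ (labels k a))
  (cong₂ _+_ (length-labels k a) (trans (LP.length-map (suc k ∷_) (labels k b)) (length-labels k b)))

length-tableau : ∀ k x → emptyCount k x + length (tableau k x) ≡ total k x
length-tableau k x = begin
  emptyCount k x + length (tableau k x)                        ≡⟨ cong (_+ length (tableau k x)) (LP.length-replicate (emptyCount k x)) ⟨
  length (replicate (emptyCount k x) []) + length (tableau k x) ≡⟨ LP.length-++ (replicate (emptyCount k x) []) ⟨
  length (replicate (emptyCount k x) [] ++ tableau k x)         ≡⟨ cong length (labels-tableau k x) ⟨
  length (labels k x)                                          ≡⟨ length-labels k x ⟩
  total k x                                                    ∎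
  where open ≡-Reasoning

LabelIn-suc : ∀ {k A} → LabelIn k A → LabelIn (suc k) A
LabelIn-suc (in-range , dec) = All.map (λ (1≤i , i≤k) → 1≤i , ℕP.m≤n⇒m≤1+n i≤k) in-range , dec

LabelIn-∷ : ∀ {k B} → LabelIn k B → LabelIn (suc k) (suc k ∷ B)
LabelIn-∷ {k} {[]}    _                      = (s≤s z≤n , ℕP.≤-refl) ∷ [] , [-]
LabelIn-∷ {k} {b ∷ B} (in-range@(b-in ∷ _) , dec) =
  ((s≤s z≤n , ℕP.≤-refl) ∷ All.map (λ (1≤i , i≤k) → 1≤i , ℕP.m≤n⇒m≤1+n i≤k) in-range) , (s≤s (proj₂ b-in) ∷ dec)

labels-LabelIn : ∀ k x → All (LabelIn k) (labels k x)
labels-LabelIn zero    x       = AllP.replicate⁺ x ([] , [])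
labels-LabelIn (suc k) (a , b) = AllP.++⁺ (All.map LabelIn-suc (labels-LabelIn k a)) (AllP.map⁺ (All.map LabelIn-∷ (labels-LabelIn k b)))

tableau-IsLabel : ∀ k x → All IsLabel (tableau k x)
tableau-IsLabel zero    x       = []
tableau-IsLabel (suc k) (a , b) = AllP.++⁺ (tableau-IsLabel k a) (AllP.map⁺ (All.map label (labels-LabelIn k b)))
  where
  label : ∀ {B} → LabelIn k B → IsLabel (suc k ∷ B)
  label ok = let in-range , dec = LabelIn-∷ ok in All.map proj₁ in-range , dec

≤ʳ-∷ : ∀ {k A} → LabelIn k A → ∀ B → A ≤ʳ (suc k ∷ B)
≤ʳ-∷ {A = []}    _                B = []≤
≤ʳ-∷ {A = x ∷ A} ((x-in ∷ _) , _) B = here (s≤s (proj₂ x-in))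

labels-sorted : ∀ k x → AllPairs _≤ʳ_ (labels k x)
labels-sorted zero    x       = AllPairs-replicate x []≤
labels-sorted (suc k) (a , b) = AllPairsP.++⁺ (labels-sorted k a) (AllPairsP.map⁺ (AllPairs.map there (labels-sorted k b)))
  (All.map (λ okA → AllP.map⁺ (All.tabulate (λ {B} _ → ≤ʳ-∷ okA B))) (labels-LabelIn k a))

tableau-sorted : ∀ k x → AllPairs _≤ʳ_ (tableau k x)
tableau-sorted k x = AllPairs-++⁻ʳ (replicate (emptyCount k x) []) (subst (AllPairs _≤ʳ_) (labels-tableau k x) (labels-sorted k x))

contentMult-++ : ∀ xs ys i → contentMult (xs ++ ys) i ≡ contentMult xs i + contentMult ys i
contentMult-++ []       ys i = refl
contentMult-++ (x ∷ xs) ys i = trans (cong (mult i x +_) (contentMult-++ xs ys i)) (sym (ℕP.+-assoc (mult i x) _ _))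

contentMult-map-∷ : ∀ j X i → contentMult (map (j ∷_) X) i ≡ length X * ind (j ≟ i) + contentMult X i
contentMult-map-∷ j []      i = refl
contentMult-map-∷ j (A ∷ X) i = trans (cong₂ _+_ (mult-∷ i j A) (contentMult-map-∷ j X i))
  (solve 4 (λ e m l c → (e :+ m) :+ (l :* e :+ c) := (con 1 :+ l) :* e :+ (m :+ c)) refl (ind (j ≟ i)) (mult i A) (length X) (contentMult X i))
  where open +-*-Solver

contentMult-empties : ∀ m i → contentMult (replicate m []) i ≡ 0
contentMult-empties zero    i = refl
contentMult-empties (suc m) i = contentMult-empties m i

contentMult-outside : ∀ k X i → All (LabelIn k) X → i ≡ 0 ⊎ k < i → contentMult X i ≡ 0
contentMult-outside k []      i _                  _       = refl
contentMult-outside k (A ∷ X) i ((in-range , _) ∷ ok) outside =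
  trans (cong (_+ contentMult X i) (mult-absent i A (All.map ≢i in-range))) (contentMult-outside k X i ok outside)
  where
  ≢outside : ∀ {x} → i ≡ 0 ⊎ k < i → 1 ≤ x × x ≤ k → x ≢ i
  ≢outside (inj₁ refl) (1≤x , _)   refl = ℕP.<-irrefl refl 1≤x
  ≢outside (inj₂ k<x)  (_   , x≤k) refl = ℕP.<-irrefl refl (ℕP.<-≤-trans k<x x≤k)
  ≢i : ∀ {x} → 1 ≤ x × x ≤ k → x ≢ i
  ≢i = ≢outside outside

contentMult-tableau : ∀ k x i → contentMult (tableau k x) i ≡ contentMult (labels k x) i
contentMult-tableau k x i = sym (begin
  contentMult (labels k x) i                                      ≡⟨ cong (λ t → contentMult t i) (labels-tableau k x) ⟩
  contentMult (replicate (emptyCount k x) [] ++ tableau k x) i    ≡⟨ contentMult-++ (replicate (emptyCount k x) []) (tableau k x) i ⟩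
  contentMult (replicate (emptyCount k x) []) i + contentMult (tableau k x) i
                                                                  ≡⟨ cong (_+ contentMult (tableau k x) i) (contentMult-empties (emptyCount k x) i) ⟩
  contentMult (tableau k x) i                                     ∎)
  where open ≡-Reasoning

contentMult-labels-suc : ∀ k a b i → contentMult (labels (suc k) (a , b)) i ≡
                         contentMult (labels k a) i + (total k b * ind (suc k ≟ i) + contentMult (labels k b) i)
contentMult-labels-suc k a b i = trans (contentMult-++ (labels k a) _ i) (cong (contentMult (labels k a) i +_)
  (trans (contentMult-map-∷ (suc k) (labels k b) i) (cong (λ t → t * ind (suc k ≟ i) + contentMult (labels k b) i) (length-labels k b))))

contentMult-labels-addʷ : ∀ k a b i → contentMult (labels k (addʷ k a b)) i ≡ contentMult (labels k a) i + contentMult (labels k b) i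
contentMult-labels-addʷ zero    a        b        i =
  trans (contentMult-empties (a + b) i) (sym (cong₂ _+_ (contentMult-empties a i) (contentMult-empties b i)))
contentMult-labels-addʷ (suc k) (a₁ , a₂) (b₁ , b₂) i = begin
  contentMult (labels (suc k) (addʷ k a₁ b₁ , addʷ k a₂ b₂)) i
    ≡⟨ contentMult-labels-suc k (addʷ k a₁ b₁) (addʷ k a₂ b₂) i ⟩
  contentMult (labels k (addʷ k a₁ b₁)) i + (total k (addʷ k a₂ b₂) * e + contentMult (labels k (addʷ k a₂ b₂)) i)
    ≡⟨ cong₂ (λ u v → u + (v * e + contentMult (labels k (addʷ k a₂ b₂)) i)) (contentMult-labels-addʷ k a₁ b₁ i) (total-addʷ k a₂ b₂) ⟩
  (cᵃ₁ + cᵇ₁) + ((total k a₂ + total k b₂) * e + contentMult (labels k (addʷ k a₂ b₂)) i)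
    ≡⟨ cong (λ t → (cᵃ₁ + cᵇ₁) + ((total k a₂ + total k b₂) * e + t)) (contentMult-labels-addʷ k a₂ b₂ i) ⟩
  (cᵃ₁ + cᵇ₁) + ((total k a₂ + total k b₂) * e + (cᵃ₂ + cᵇ₂))
    ≡⟨ solve 7 (λ x y u v e p q → (x :+ y) :+ ((u :+ v) :* e :+ (p :+ q)) := (x :+ (u :* e :+ p)) :+ (y :+ (v :* e :+ q)))
         refl cᵃ₁ cᵇ₁ (total k a₂) (total k b₂) e cᵃ₂ cᵇ₂ ⟩
  (cᵃ₁ + (total k a₂ * e + cᵃ₂)) + (cᵇ₁ + (total k b₂ * e + cᵇ₂))
    ≡⟨ cong₂ _+_ (contentMult-labels-suc k a₁ a₂ i) (contentMult-labels-suc k b₁ b₂ i) ⟨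
  contentMult (labels (suc k) (a₁ , a₂)) i + contentMult (labels (suc k) (b₁ , b₂)) i ∎
  where
  open ≡-Reasoning
  open +-*-Solver
  e = ind (suc k ≟ i)
  cᵃ₁ = contentMult (labels k a₁) i
  cᵇ₁ = contentMult (labels k b₁) i
  cᵃ₂ = contentMult (labels k a₂) i
  cᵇ₂ = contentMult (labels k b₂) i

contentMult-labels-≤ : ∀ k a b i → i ≤ k → contentMult (labels (suc k) (a , b)) i ≡ contentMult (labels k (addʷ k a b)) i
contentMult-labels-≤ k a b i i≤k = begin
  contentMult (labels (suc k) (a , b)) i
    ≡⟨ contentMult-labels-suc k a b i ⟩
  contentMult (labels k a) i + (total k b * ind (suc k ≟ i) + contentMult (labels k b) i)
    ≡⟨ cong (λ e → contentMult (labels k a) i + (total k b * e + contentMult (labels k b) i)) (ind-no (suc k ≟ i) (λ { refl → ℕP.<-irrefl refl (s≤s i≤k) })) ⟩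
  contentMult (labels k a) i + (total k b * 0 + contentMult (labels k b) i)
    ≡⟨ cong (λ t → contentMult (labels k a) i + (t + contentMult (labels k b) i)) (ℕP.*-zeroʳ (total k b)) ⟩
  contentMult (labels k a) i + contentMult (labels k b) i
    ≡⟨ contentMult-labels-addʷ k a b i ⟨
  contentMult (labels k (addʷ k a b)) i ∎
  where open ≡-Reasoning

contentMult-labels-top : ∀ k a b → contentMult (labels (suc k) (a , b)) (suc k) ≡ total k b
contentMult-labels-top k a b = begin
  contentMult (labels (suc k) (a , b)) (suc k)
    ≡⟨ contentMult-labels-suc k a b (suc k) ⟩
  contentMult (labels k a) (suc k) + (total k b * ind (suc k ≟ suc k) + contentMult (labels k b) (suc k))
    ≡⟨ cong₂ (λ u v → u + (total k b * ind (suc k ≟ suc k) + v)) (beyond a) (beyond b) ⟩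
  0 + (total k b * ind (suc k ≟ suc k) + 0)
    ≡⟨ cong (λ e → total k b * e + 0) (ind-yes (suc k ≟ suc k) refl) ⟩
  total k b * 1 + 0
    ≡⟨ trans (ℕP.+-identityʳ _) (ℕP.*-identityʳ _) ⟩
  total k b ∎
  where
  open ≡-Reasoning
  beyond : ∀ w → contentMult (labels k w) (suc k) ≡ 0
  beyond w = contentMult-outside k (labels k w) (suc k) (labels-LabelIn k w) (inj₂ ℕP.≤-refl)

module MarginsContent (ν : ℕ → ℕ) where

  open Margins ν

  hasMargins⇒contentMult : ∀ k x → T (hasMargins k x) → ∀ {i} → 1 ≤ i → i ≤ k → contentMult (labels k x) i ≡ ν i
  hasMargins⇒contentMult zero    x       _   (s≤s _) ()
  hasMargins⇒contentMult (suc k) (a , b) has {i} 1≤i i≤k+1 with Equivalence.to T-∧ has | ℕP.m≤n⇒m<n∨m≡n i≤k+1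
  ... | has-a⊕b , _     | inj₁ (s≤s i≤k) = trans (contentMult-labels-≤ k a b i i≤k) (hasMargins⇒contentMult k (addʷ k a b) has-a⊕b 1≤i i≤k)
  ... | _       , has-b | inj₂ refl      = trans (contentMult-labels-top k a b) (T-does⁻ (total k b ≟ ν (suc k)) has-b)

  contentMult⇒hasMargins : ∀ k x → (∀ {i} → 1 ≤ i → i ≤ k → contentMult (labels k x) i ≡ ν i) → T (hasMargins k x)
  contentMult⇒hasMargins zero    x       _       = _
  contentMult⇒hasMargins (suc k) (a , b) content = Equivalence.from T-∧
    ( contentMult⇒hasMargins k (addʷ k a b) (λ 1≤i i≤k → trans (sym (contentMult-labels-≤ k a b _ i≤k)) (content 1≤i (ℕP.m≤n⇒m≤1+n i≤k)))
    , T-does⁺ (total k b ≟ ν (suc k)) (trans (sym (contentMult-labels-top k a b)) (content (s≤s z≤n) ℕP.≤-refl)))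

HeadIs : ℕ → List ℕ → Set
HeadIs j []      = ⊥
HeadIs j (x ∷ _) = x ≡ j

headIs? : ∀ j → Decidable (HeadIs j)
headIs? j []      = no (λ ())
headIs? j (x ∷ _) = x ≟ j

-- the inverse of labels on sorted rows: split off the labels containing k, recursively
weightOf : ∀ k → List (List ℕ) → Weight k
weightOf zero    T = length T
weightOf (suc k) T = weightOf k (filter (∁? (headIs? (suc k))) T) , weightOf k (map (drop 1) (filter (headIs? (suc k)) T))

private
  below-head : ∀ {x A} → Linked (λ u v → v < u) (x ∷ A) → All (_< x) A
  below-head {A = []}    _         = []
  below-head {A = y ∷ A} (y<x ∷ l) = LinkedP.Linked⇒All (λ p q → ℕP.<-trans q p) y<x l

  LabelIn-¬HeadIs : ∀ {k A} → LabelIn (suc k) A → ¬ HeadIs (suc k) A → LabelIn k A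
  LabelIn-¬HeadIs {k} {[]}    _                                  _      = [] , []
  LabelIn-¬HeadIs {k} {x ∷ A} (((1≤x , x≤k+1) ∷ in-range) , dec) x≢k+1 =
    ((1≤x , x≤k) ∷ All.zipWith (λ ((1≤y , _) , y<x) → 1≤y , ℕP.≤-trans (ℕP.n≤1+n _) (ℕP.≤-trans y<x x≤k)) (in-range , below-head dec)) , dec
    where x≤k = ℕP.≤-pred (ℕP.≤∧≢⇒< x≤k+1 x≢k+1)

  LabelIn-drop : ∀ {k A} → LabelIn (suc k) A → HeadIs (suc k) A → LabelIn k (drop 1 A)
  LabelIn-drop {k} {x ∷ A} ((_ ∷ in-range) , dec) refl =
    All.zipWith (λ ((1≤y , _) , y<x) → 1≤y , ℕP.≤-pred y<x) (in-range , below-head dec) , Linked-tail dec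
    where
    Linked-tail : ∀ {x A} → Linked (λ u v → v < u) (x ∷ A) → Linked (λ u v → v < u) A
    Linked-tail [-]      = []
    Linked-tail (_ ∷ l) = l

  LabelIn-zero : ∀ T → All (LabelIn 0) T → T ≡ replicate (length T) []
  LabelIn-zero []             _                             = refl
  LabelIn-zero ([] ∷ T)       (_ ∷ ok)                      = cong ([] ∷_) (LabelIn-zero T ok)
  LabelIn-zero ((x ∷ A) ∷ T) ((((1≤x , x≤0) ∷ _) , _) ∷ _) = ⊥-elim (ℕP.<-irrefl refl (ℕP.<-≤-trans 1≤x x≤0))

  map-∷-drop : ∀ j G → All (HeadIs j) G → map (j ∷_) (map (drop 1) G) ≡ G
  map-∷-drop j []            _          = refl
  map-∷-drop j ((x ∷ A) ∷ G) (refl ∷ h) = cong ((x ∷ A) ∷_) (map-∷-drop j G h)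

  ≤ʳ-drop : ∀ {j A B} → HeadIs j A → HeadIs j B → A ≤ʳ B → drop 1 A ≤ʳ drop 1 B
  ≤ʳ-drop {A = x ∷ A} {x ∷ B} refl refl (here x<x) = ⊥-elim (ℕP.<-irrefl refl x<x)
  ≤ʳ-drop {A = x ∷ A} {x ∷ B} _    _    (there p)  = p

  AllPairs-drop : ∀ j G → All (HeadIs j) G → AllPairs _≤ʳ_ G → AllPairs _≤ʳ_ (map (drop 1) G)
  AllPairs-drop j []      _          _                = []
  AllPairs-drop j (A ∷ G) (hA ∷ hG) (A≤G ∷ sorted) = All.tabulate drop-≤ ∷ AllPairs-drop j G hG sorted
    where
    drop-≤ : ∀ {y} → y ∈ map (drop 1) G → drop 1 A ≤ʳ y
    drop-≤ y∈ with ∈-map⁻ (drop 1) y∈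
    ... | B , B∈ , refl = ≤ʳ-drop hA (All.lookup hG B∈) (All.lookup A≤G B∈)

  filter-∁-++-filter : ∀ {P : List ℕ → Set} (P? : Decidable P) xs → AllPairs _≤ʳ_ xs →
    (∀ {A B} → A ∈ xs → B ∈ xs → A ≤ʳ B → P A → P B) → filter (∁? P?) xs ++ filter P? xs ≡ xs
  filter-∁-++-filter P? []       _               _  = refl
  filter-∁-++-filter P? (x ∷ xs) (x≤xs ∷ sorted) up with P? x
  ... | yes Px = cong₂ _++_ (LP.filter-none (∁? P?) (All.map (λ Py ¬Py → ¬Py Py) all-P)) (cong (x ∷_) (LP.filter-all P? all-P))
    where
    all-P : All _ xs
    all-P = All.tabulate (λ y∈ → up (here refl) (there y∈) (All.lookup x≤xs y∈) Px)
  ... | no ¬Px = cong (x ∷_) (filter-∁-++-filter P? xs sorted (λ A∈ B∈ → up (there A∈) (there B∈)))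

≤ʳ-trans : ∀ {A B C} → A ≤ʳ B → B ≤ʳ C → A ≤ʳ C
≤ʳ-trans []≤         _           = []≤
≤ʳ-trans (here x<y)  (here y<z)  = here (ℕP.<-trans x<y y<z)
≤ʳ-trans (here x<y)  (there _)   = here x<y
≤ʳ-trans (there _)   (here y<z)  = here y<z
≤ʳ-trans (there A≤B) (there B≤C) = there (≤ʳ-trans A≤B B≤C)

weightOf-labels : ∀ k x → weightOf k (labels k x) ≡ x
weightOf-labels zero    x       = LP.length-replicate x
weightOf-labels (suc k) (a , b) = cong₂ _,_ (trans (cong (weightOf k) avoiding) (weightOf-labels k a))
                                            (trans (cong (weightOf k) containing) (weightOf-labels k b))
  where
  P? = headIs? (suc k)
  ¬head : ∀ {A} → LabelIn k A → ¬ HeadIs (suc k) A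
  ¬head {x ∷ A} ((x-in ∷ _) , _) refl = ℕP.<-irrefl refl (s≤s (proj₂ x-in))
  heads : All (HeadIs (suc k)) (map (suc k ∷_) (labels k b))
  heads = AllP.map⁺ (All.tabulate (λ _ → refl))
  avoiding : filter (∁? P?) (labels k a ++ map (suc k ∷_) (labels k b)) ≡ labels k a
  avoiding = trans (LP.filter-++ (∁? P?) (labels k a) _)
    (trans (cong₂ _++_ (LP.filter-all (∁? P?) (All.map ¬head (labels-LabelIn k a)))
                       (LP.filter-none (∁? P?) (All.map (λ h ¬h → ¬h h) heads)))
           (LP.++-identityʳ _))
  containing : map (drop 1) (filter P? (labels k a ++ map (suc k ∷_) (labels k b))) ≡ labels k b
  containing = trans (cong (map (drop 1)) (trans (LP.filter-++ P? (labels k a) _)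
                       (cong₂ _++_ (LP.filter-none P? (All.map ¬head (labels-LabelIn k a))) (LP.filter-all P? heads))))
                     (trans (sym (LP.map-∘ (labels k b))) (LP.map-id (labels k b)))

labels-weightOf : ∀ k T → All (LabelIn k) T → AllPairs _≤ʳ_ T → labels k (weightOf k T) ≡ T
labels-weightOf zero    T ok _      = sym (LabelIn-zero T ok)
labels-weightOf (suc k) T ok sorted = begin
  labels k (weightOf k F) ++ map (suc k ∷_) (labels k (weightOf k (map (drop 1) G)))
    ≡⟨ cong₂ (λ u v → u ++ map (suc k ∷_) v)
         (labels-weightOf k F okF (AllPairsP.filter⁺ (∁? P?) sorted))
         (labels-weightOf k (map (drop 1) G) okG (AllPairs-drop (suc k) G headsG (AllPairsP.filter⁺ P? sorted))) ⟩
  F ++ map (suc k ∷_) (map (drop 1) G)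
    ≡⟨ cong (F ++_) (map-∷-drop (suc k) G headsG) ⟩
  F ++ G
    ≡⟨ filter-∁-++-filter P? T sorted up ⟩
  T ∎
  where
  open ≡-Reasoning
  P? = headIs? (suc k)
  F = filter (∁? P?) T
  G = filter P? T
  okF : All (LabelIn k) F
  okF = All.tabulate (λ A∈ → let A∈T , ¬hA = ∈-filter⁻ (∁? P?) {xs = T} A∈ in LabelIn-¬HeadIs (All.lookup ok A∈T) ¬hA)
  headsG : All (HeadIs (suc k)) G
  headsG = All.tabulate (λ A∈ → proj₂ (∈-filter⁻ P? {xs = T} A∈))
  okG : All (LabelIn k) (map (drop 1) G)
  okG = AllP.map⁺ (All.tabulate (λ A∈ → let A∈T , hA = ∈-filter⁻ P? {xs = T} A∈ in LabelIn-drop (All.lookup ok A∈T) hA))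
  up : ∀ {A B} → A ∈ T → B ∈ T → A ≤ʳ B → HeadIs (suc k) A → HeadIs (suc k) B
  up {x ∷ A} {y ∷ B} _ B∈ (here x<y) refl with All.lookup ok B∈
  ... | ((_ , y≤k+1) ∷ _) , _ = ⊥-elim (ℕP.<-irrefl refl (ℕP.<-≤-trans x<y y≤k+1))
  up {x ∷ A} {x ∷ B} _ _ (there _) hA = hA

∑-indB≡length-filter : ∀ (p : A → Bool) xs → ℕΣ.∑ xs (λ x → indB (p x)) ≡ length (filter (λ x → T? (p x)) xs)
∑-indB≡length-filter p []       = refl
∑-indB≡length-filter p (x ∷ xs) with p x
... | true  = cong suc (∑-indB≡length-filter p xs)
... | false = ∑-indB≡length-filter p xs

replicate-[]-++-cancel : ∀ m m′ (U V : List (List ℕ)) → replicate m [] ++ U ≡ replicate m′ [] ++ V →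
                         All (_≢ []) U → All (_≢ []) V → U ≡ V
replicate-[]-++-cancel zero     zero      U       V       eq _           _           = eq
replicate-[]-++-cancel zero     (suc m′)  (A ∷ U) V       eq (A≢[] ∷ _) _           = ⊥-elim (A≢[] (LP.∷-injectiveˡ eq))
replicate-[]-++-cancel (suc m)  zero      U       (B ∷ V) eq _           (B≢[] ∷ _) = ⊥-elim (B≢[] (sym (LP.∷-injectiveˡ eq)))
replicate-[]-++-cancel (suc m)  (suc m′)  U       V       eq U≢[]        V≢[]        = replicate-[]-++-cancel m m′ U V (LP.∷-injectiveʳ eq) U≢[] V≢[]

mult-∈ : ∀ {i A} → i ∈ A → 1 ≤ mult i A
mult-∈ {i} {x ∷ A} (here refl) = subst (1 ≤_) (sym (mult-∷-≡ i A)) (s≤s z≤n)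
mult-∈ {i} {x ∷ A} (there i∈)  = subst (1 ≤_) (sym (mult-∷ i x A)) (ℕP.≤-trans (mult-∈ i∈) (ℕP.m≤n+m _ _))

mult≤contentMult : ∀ i {A T} → A ∈ T → mult i A ≤ contentMult T i
mult≤contentMult i {T = B ∷ T} (here refl) = ℕP.m≤m+n _ _
mult≤contentMult i {T = B ∷ T} (there A∈)  = ℕP.≤-trans (mult≤contentMult i A∈) (ℕP.m≤n+m _ _)

module CountedTableaux (d a k : ℕ) (a≤k : a ≤ k) where

  open TargetMargins d a k a≤k
  open MarginsContent (targetMult d a k)

  marginWeights : List (Weight k)
  marginWeights = filter (λ w → T? (hasMargins k w)) (weightsOfTotal k (2 * d))

  countedTableaux : List (List (List ℕ))
  countedTableaux = map (tableau k) marginWeights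

  length-countedTableaux : ℕΣ.∑ (weightsOfTotal k (2 * d)) (λ w → indB (hasMargins k w)) ≡ length countedTableaux
  length-countedTableaux = trans (∑-indB≡length-filter (hasMargins k) (weightsOfTotal k (2 * d)))
                                 (sym (LP.length-map (tableau k) marginWeights))

  private
    marginWeight⁻ : ∀ {x} → x ∈ marginWeights → total k x ≡ 2 * d × T (hasMargins k x)
    marginWeight⁻ x∈ = let x∈W , has = ∈-filter⁻ (λ w → T? (hasMargins k w)) {xs = weightsOfTotal k (2 * d)} x∈
                       in total-weightsOfTotal k x∈W , has

    emptyCount-marginWeight : ∀ {x} → x ∈ marginWeights → emptyCount k x ≡ 2 * d ∸ length (tableau k x)
    emptyCount-marginWeight {x} x∈ = sym (trans (cong (_∸ length (tableau k x)) (sym (trans (length-tableau k x) (proj₁ (marginWeight⁻ x∈)))))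
                                                (ℕP.m+n∸n≡m (emptyCount k x) (length (tableau k x))))

    tableau-injective : ∀ {x y} → x ∈ marginWeights → y ∈ marginWeights → tableau k x ≡ tableau k y → x ≡ y
    tableau-injective {x} {y} x∈ y∈ eq = begin
      x                                                     ≡⟨ weightOf-labels k x ⟨
      weightOf k (labels k x)                               ≡⟨ cong (weightOf k) (labels-tableau k x) ⟩
      weightOf k (replicate (emptyCount k x) [] ++ tableau k x)
        ≡⟨ cong₂ (λ m t → weightOf k (replicate m [] ++ t))
             (trans (emptyCount-marginWeight x∈) (trans (cong (λ t → 2 * d ∸ length t) eq) (sym (emptyCount-marginWeight y∈)))) eq ⟩
      weightOf k (replicate (emptyCount k y) [] ++ tableau k y) ≡⟨ cong (weightOf k) (labels-tableau k y) ⟨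
      weightOf k (labels k y)                               ≡⟨ weightOf-labels k y ⟩
      y                                                     ∎
      where open ≡-Reasoning

  countedTableaux-unique : Unique countedTableaux
  countedTableaux-unique = Unique-map⁺-injectiveOn (tableau k) tableau-injective
    (UniqueP.filter⁺ (λ w → T? (hasMargins k w)) (weightsOfTotal-unique k (2 * d)))

  countedTableaux-sound : ∀ {T} → T ∈ countedTableaux → Counted d a k T
  countedTableaux-sound T∈ with ∈-map⁻ (tableau k) T∈
  ... | x , x∈ , refl = length≤ , (refl , tableau-IsLabel k x , LinkedP.AllPairs⇒Linked (tableau-sorted k x)) , content
    where
    length≤ : length (tableau k x) ≤ 2 * d
    length≤ = subst (length (tableau k x) ≤_) (trans (length-tableau k x) (proj₁ (marginWeight⁻ x∈)))
                    (ℕP.m≤n+m (length (tableau k x)) (emptyCount k x))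
    content : ∀ i → contentMult (tableau k x) i ≡ targetMult d a k i
    content zero    = trans (contentMult-tableau k x 0) (contentMult-outside k (labels k x) 0 (labels-LabelIn k x) (inj₁ refl))
    content (suc j) with suc j ≤? k
    ... | yes j<k = trans (contentMult-tableau k x (suc j)) (hasMargins⇒contentMult k x (proj₂ (marginWeight⁻ x∈)) (s≤s z≤n) j<k)
    ... | no  j≮k = trans (contentMult-tableau k x (suc j))
      (trans (contentMult-outside k (labels k x) (suc j) (labels-LabelIn k x) (inj₂ (ℕP.≰⇒> j≮k)))
             (sym (targetMult->k d a k a≤k (ℕP.≰⇒> j≮k))))

  private
    content⇒LabelIn : ∀ {row} → (∀ i → contentMult row i ≡ targetMult d a k i) → All IsLabel row → All (LabelIn k) row
    content⇒LabelIn {row} content isLabels = All.tabulate (λ {A} A∈ → LabelIn-of A (All.lookup isLabels A∈) (entries≤k A∈))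
      where
      entries≤k : ∀ {A} → A ∈ row → ∀ {i} → i ∈ A → i ≤ k
      entries≤k A∈ {i} i∈ with i ≤? k
      ... | yes i≤k = i≤k
      ... | no  i≰k = ⊥-elim (ℕP.<-irrefl refl (ℕP.≤-trans (ℕP.≤-trans (mult-∈ i∈) (mult≤contentMult i A∈))
                                                          (ℕP.≤-reflexive (trans (content i) (targetMult->k d a k a≤k (ℕP.≰⇒> i≰k))))))
      LabelIn-of : ∀ A → IsLabel A → (∀ {i} → i ∈ A → i ≤ k) → LabelIn k A
      LabelIn-of (x ∷ A) (positive , dec) ≤k = All.tabulate (λ i∈ → All.lookup positive i∈ , ≤k i∈) , dec

  countedTableaux-complete : ∀ {row} → Counted d a k row → row ∈ countedTableaux
  countedTableaux-complete {row} (length≤ , (_ , isLabels , linked) , content) =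
    subst (_∈ countedTableaux) tableau-x≡row (∈-map⁺ (tableau k) (∈-filter⁺ (λ w → T? (hasMargins k w)) x∈W has-x))
    where
    m = 2 * d ∸ length row
    padded = replicate m [] ++ row
    x = weightOf k padded
    labels-x : labels k x ≡ padded
    labels-x = labels-weightOf k padded (AllP.++⁺ (AllP.replicate⁺ m ([] , [])) (content⇒LabelIn content isLabels))
      (AllPairsP.++⁺ (AllPairs-replicate m []≤) (LinkedP.Linked⇒AllPairs ≤ʳ-trans linked) (AllP.replicate⁺ m (All.tabulate (λ _ → []≤))))
    total-x : total k x ≡ 2 * d
    total-x = begin
      total k x                          ≡⟨ length-labels k x ⟨
      length (labels k x)                ≡⟨ cong length labels-x ⟩
      length padded                      ≡⟨ LP.length-++ (replicate m []) ⟩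
      length (replicate m []) + length row ≡⟨ cong (_+ length row) (LP.length-replicate m) ⟩
      m + length row                     ≡⟨ ℕP.m∸n+n≡m length≤ ⟩
      2 * d                              ∎
      where open ≡-Reasoning
    x∈W : x ∈ weightsOfTotal k (2 * d)
    x∈W = subst (λ t → x ∈ weightsOfTotal k t) total-x (∈-weightsOfTotal k x)
    has-x : T (hasMargins k x)
    has-x = contentMult⇒hasMargins k x (λ {i} _ _ → begin
      contentMult (labels k x) i                         ≡⟨ cong (λ t → contentMult t i) labels-x ⟩
      contentMult padded i                               ≡⟨ contentMult-++ (replicate m []) row i ⟩
      contentMult (replicate m []) i + contentMult row i ≡⟨ cong (_+ contentMult row i) (contentMult-empties m i) ⟩
      contentMult row i                                  ≡⟨ content i ⟩
      targetMult d a k i                                 ∎)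
      where open ≡-Reasoning
    tableau-x≡row : tableau k x ≡ row
    tableau-x≡row = replicate-[]-++-cancel (emptyCount k x) m (tableau k x) row (trans (sym (labels-tableau k x)) labels-x)
      (All.map label≢[] (tableau-IsLabel k x)) (All.map label≢[] isLabels)
      where
      label≢[] : ∀ {A} → IsLabel A → A ≢ []
      label≢[] {x ∷ A} _ ()

-- imported last: the prefix +_ makes sections such as (p +_) ambiguous
open import Data.Integer using (+_)

mainTheorem9 : (d a k : ℕ) → 1 ≤ d → a ≤ k →
    Σ (List (List (List ℕ))) (λ L →
    Unique L ×
    ((T : List (List ℕ)) → (T ∈ L) ⇔ Counted d a k T) ×
    (coeffSRow (2 * d) (kronAll (factors d a k)) ≡ (+ length L) / 1))
mainTheorem9 d a k 1≤d a≤k =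
  countedTableaux , countedTableaux-unique , (λ T → mk⇔ countedTableaux-sound countedTableaux-complete) ,
  trans (coeffSRow-kronAll-factors 1≤d) (cong fromℕ length-countedTableaux)
  where
  open TargetMargins d a k a≤k using (coeffSRow-kronAll-factors)
  open CountedTableaux d a k a≤k
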